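{- For every finite simple graph $G$ with vertex set $[n]$, $\mathrm{isf}(G)\le \mathrm{ao}(G)$, with equality if and only if the ordering $1,2,\dots,n$ is a perfect elimination ordering of $G$.
   Context: $\mathrm{isf}(G)$ is the number of increasing spanning forests of $G$: edge sets forming a forest such that in each component, rooted at its smallest vertex, labels increase along every path from the root. $\mathrm{ao}(G)$ is the number of acyclic orientations of $G$. The ordering $1,\dots,n$ is a perfect elimination ordering if for all $i<j<k$, $ik,jk\in E(G)$ implies $ij\in E(G)$. -}

module Defs where

open import Data.Bool using (Bool; true; false; _∧_)
open import Data.Nat using (ℕ; zero; suc; _≤_) renaming (_<ᵇ_ to _ℕ<ᵇ_)
open import Data.Fin using (Fin; toℕ) renaming (_<_ to _<ᶠ_; _≤_ to _≤ᶠ_)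
open import Data.List using (List; []; _∷_; _++_; map; length; take; allFin; cartesianProduct; filterᵇ)
open import Data.List.Membership.Propositional using (_∈_)
open import Data.List.Relation.Unary.Linked using (Linked)
open import Data.List.Relation.Unary.Unique.Propositional using (Unique)
open import Data.Product using (Σ; _×_; _,_; proj₁; proj₂)
open import Data.Sum using (_⊎_)
open import Relation.Binary.PropositionalEquality using (_≡_)
open import Relation.Nullary using (¬_)

-- Finite simple graphs on the vertex set [n] = Fin n
-- (vertex i : Fin n stands for the label toℕ i + 1; the order is the
-- same, which is all that matters).

record Graph (n : ℕ) : Set where
  field
    adj    : Fin n → Fin n → Bool
    sym    : ∀ i j → adj i j ≡ adj j i
    irrefl : ∀ i → adj i i ≡ false

open Graph public

Edge : ℕ → Set
Edge n = Fin n × Fin n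

edges : ∀ {n} → Graph n → List (Edge n)
edges {n} G =
  filterᵇ (λ e → (toℕ (proj₁ e) ℕ<ᵇ toℕ (proj₂ e)) ∧ adj G (proj₁ e) (proj₂ e))
          (cartesianProduct (allFin n) (allFin n))

sublists : ∀ {A : Set} → List A → List (List A)
sublists []       = [] ∷ []
sublists (x ∷ xs) = map (x ∷_) (sublists xs) ++ sublists xs

orientations : ∀ {n} → List (Edge n) → List (List (Edge n))
orientations []            = [] ∷ []
orientations ((i , j) ∷ es) =
  map ((i , j) ∷_) (orientations es) ++ map ((j , i) ∷_) (orientations es)

data CountIn {A : Set} (P : A → Set) : List A → ℕ → Set where
  c-nil  : CountIn P [] zero
  c-yes  : ∀ {x xs k} → P x → CountIn P xs k → CountIn P (x ∷ xs) (suc k)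
  c-no   : ∀ {x xs k} → ¬ P x → CountIn P xs k → CountIn P (x ∷ xs) k

FAdj : ∀ {n} → List (Edge n) → Fin n → Fin n → Set
FAdj F u v = ((u , v) ∈ F) ⊎ ((v , u) ∈ F)

HasCycle : ∀ {n} → List (Edge n) → Set
HasCycle {n} F = Σ (List (Fin n)) λ vs →
  Unique vs × (3 ≤ length vs) × Linked (FAdj F) (vs ++ take 1 vs)

IsForest : ∀ {n} → List (Edge n) → Set
IsForest F = ¬ HasCycle F

Reachable : ∀ {n} → List (Edge n) → Fin n → Fin n → Set
Reachable {n} F v w = Σ (List (Fin n)) λ vs → Linked (FAdj F) (v ∷ vs ++ w ∷ [])

IsRoot : ∀ {n} → List (Edge n) → Fin n → Set
IsRoot F r = ∀ w → Reachable F r w → r ≤ᶠ w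

IsIncreasing : ∀ {n} → List (Edge n) → Set
IsIncreasing {n} F = ∀ (r : Fin n) (vs : List (Fin n)) →
  IsRoot F r → Unique (r ∷ vs) → Linked (FAdj F) (r ∷ vs) →
  Linked _<ᶠ_ (r ∷ vs)

IsISF : ∀ {n} → List (Edge n) → Set
IsISF F = IsForest F × IsIncreasing F

isf≡ : ∀ {n} → Graph n → ℕ → Set
isf≡ G k = CountIn IsISF (sublists (edges G)) k

HasDirCycle : ∀ {n} → List (Edge n) → Set
HasDirCycle {n} O = Σ (List (Fin n)) λ vs →
  Unique vs × (2 ≤ length vs) × Linked (λ u v → (u , v) ∈ O) (vs ++ take 1 vs)

IsAcyclic : ∀ {n} → List (Edge n) → Set
IsAcyclic O = ¬ HasDirCycle O

ao≡ : ∀ {n} → Graph n → ℕ → Set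
ao≡ G k = CountIn IsAcyclic (orientations (edges G)) k

IsPEO : ∀ {n} → Graph n → Set
IsPEO {n} G = ∀ (i j k : Fin n) → i <ᶠ j → j <ᶠ k →
  adj G i k ≡ true → adj G j k ≡ true → adj G i j ≡ true

module Submission where

-- An increasing spanning forest is the same as an edge set in which
-- every vertex has at most one parent (smaller neighbour), i.e. a parent
-- function.  Give every vertex its key, the labels on the forest path from
-- its root, and orient each edge of G towards the endpoint whose key comes
-- later in a lexicographic order ≺.  This key orientation is acyclic and
-- determines the forest, since the parent of v is the ≺-last in-neighbour
-- of v below v; hence isf(G) ≤ ao(G).  Under a perfect elimination
-- ordering the lower neighbours of each vertex form a clique, and every
-- acyclic orientation is the key orientation of its "sink parent
-- function", so the counts agree.  Conversely a violation i < j < k with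
-- minimal apex k yields an acyclic orientation, squeezing i, k, j together,
-- that is no key orientation, so isf(G) < ao(G).

open import Defs hiding (sym)
open import Data.Bool using (Bool; true; false; _∧_)
open import Data.Bool.Properties using (T-∧; T-≡) renaming (_≟_ to _≟ᵇ_)
open import Data.Empty using (⊥; ⊥-elim)
open import Data.Fin using (Fin; toℕ) renaming (_<_ to _<ᶠ_)
open import Data.Fin.Properties using (toℕ-injective; toℕ<n; any?; all?) renaming (_≟_ to _≟ᶠ_)
open import Data.List using (List; []; _∷_; _++_; [_]; _∷ʳ_; initLast; _∷ʳ′_; map; length; filter; cartesianProduct; allFin)
open import Data.List.Properties using (∷-injective; ++-assoc; length-++; length-map; ∷ʳ-injectiveʳ)
import Data.List.Properties as ListP
open import Data.List.Membership.Propositional using (_∈_; _∉_)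
open import Data.List.Membership.Propositional.Properties
import Data.List.Membership.DecPropositional as DecMembership
open import Data.List.Relation.Unary.Any using (here; there)
open import Data.List.Relation.Unary.All as All using (All; []; _∷_)
open import Data.List.Relation.Unary.All.Properties using (++⁺)
open import Data.List.Relation.Unary.AllPairs as AllPairs using ([]; _∷_)
open import Data.List.Relation.Unary.Linked as Linked using (Linked; []; [-]; _∷_)
open import Data.List.Relation.Unary.Unique.Propositional using (Unique)
import Data.List.Relation.Unary.Unique.Propositional.Properties as UniqueP
open import Data.Maybe using (Maybe; just; nothing)
open import Data.Maybe.Properties using (just-injective)
import Data.Maybe.Properties as MaybeP
open import Data.Nat using (ℕ; zero; suc; _≟_; _+_; _≤_; _<_; z≤n; s≤s; _≤?_; _<?_; _<ᵇ_)
open import Data.Nat.Properties using (≤-refl; ≤-trans; ≤-antisym; <-trans; <-irrefl; <-asym; <-cmp; <⇒≤; ≰⇒>; <-≤-trans; ≤-<-trans; <ᵇ⇒<; <⇒<ᵇ; m≤n+m)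
open import Data.Product using (Σ; ∃; _×_; _,_; proj₁; proj₂; uncurry)
import Data.Product.Properties as ProductP
open import Data.Sum using (_⊎_; inj₁; inj₂) renaming (map to ⊎-map)
open import Data.Unit using (⊤; tt)
open import Function.Bundles using (_⇔_; mk⇔; Equivalence)
open import Relation.Binary.Definitions using (DecidableEquality; tri<; tri≈; tri>)
open import Relation.Binary.PropositionalEquality using (_≡_; _≢_; refl; sym; trans; cong; cong₂; subst; subst₂; module ≡-Reasoning)
open import Relation.Nullary using (¬_; Dec; yes; no; does; ¬?)
open import Relation.Nullary.Decidable using (T?; decidable-stable; does-⇔; dec-true; dec-false; _×-dec_; _⊎-dec_; _→-dec_)

-- A proof of `CountIn P xs k` singles out the entries of xs satisfying P;
-- listing them turns statements about the number k into statements about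
-- lists, and an injection between such lists compares two counts.

module _ {A : Set} {P : A → Set} where

  witnesses : ∀ {xs k} → CountIn P xs k → List A
  witnesses c-nil              = []
  witnesses (c-yes {x = x} _ c) = x ∷ witnesses c
  witnesses (c-no _ c)         = witnesses c

  witnesses-length : ∀ {xs k} (c : CountIn P xs k) → length (witnesses c) ≡ k
  witnesses-length c-nil       = refl
  witnesses-length (c-yes _ c) = cong suc (witnesses-length c)
  witnesses-length (c-no _ c)  = witnesses-length c

  witnesses-sound : ∀ {xs k} (c : CountIn P xs k) {z} → z ∈ witnesses c → z ∈ xs × P z
  witnesses-sound (c-yes p c) (here refl) = here refl , p
  witnesses-sound (c-yes p c) (there m)   = let (m′ , pz) = witnesses-sound c m in there m′ , pz
  witnesses-sound (c-no _ c)  m           = let (m′ , pz) = witnesses-sound c m in there m′ , pz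

  witnesses-unique : ∀ {xs k} (c : CountIn P xs k) → Unique xs → Unique (witnesses c)
  witnesses-unique c-nil       _       = []
  witnesses-unique (c-yes p c) (h ∷ u) =
    All.tabulate (λ m → All.lookup h (proj₁ (witnesses-sound c m))) ∷ witnesses-unique c u
  witnesses-unique (c-no _ c)  (h ∷ u) = witnesses-unique c u

module _ {B : Set} (_≟_ : DecidableEquality B) where

  delete : B → List B → List B
  delete y = filter (λ z → ¬? (z ≟ y))

  delete-sound : ∀ y zs {z} → z ∈ delete y zs → z ∈ zs × z ≢ y
  delete-sound y zs = ∈-filter⁻ (λ z → ¬? (z ≟ y))

  delete-unique : ∀ y {zs} → Unique zs → Unique (delete y zs)
  delete-unique y = UniqueP.filter⁺ (λ z → ¬? (z ≟ y))

  delete-absent : ∀ y zs → y ∉ zs → length zs ≤ length (delete y zs)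
  delete-absent y []       _  = z≤n
  delete-absent y (z ∷ zs) y∉ with z ≟ y
  ... | yes refl = ⊥-elim (y∉ (here refl))
  ... | no _     = s≤s (delete-absent y zs (λ m → y∉ (there m)))

  delete-length : ∀ y zs → Unique zs → length zs ≤ suc (length (delete y zs))
  delete-length y []       _       = z≤n
  delete-length y (z ∷ zs) (h ∷ u) with z ≟ y
  ... | yes refl = s≤s (delete-absent z zs (λ m → All.lookup h m refl))
  ... | no _     = s≤s (delete-length y zs u)

  pigeonhole : ∀ {Q : B → Set} {ys b} → CountIn Q ys b → (zs : List B) → Unique zs →
               (∀ {z} → z ∈ zs → z ∈ ys × Q z) → length zs ≤ b
  pigeonhole c-nil []       _ _   = z≤n
  pigeonhole c-nil (z ∷ zs) _ sub with proj₁ (sub (here refl))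
  ... | ()
  pigeonhole {Q} (c-yes {x = y} {xs = ys} _ c) zs u sub =
    ≤-trans (delete-length y zs u) (s≤s (pigeonhole c (delete y zs) (delete-unique y u) sub′))
    where
    sub′ : ∀ {z} → z ∈ delete y zs → z ∈ ys × Q z
    sub′ m with delete-sound y zs m
    ... | m′ , z≢y with sub m′
    ... | here z≡y , _  = ⊥-elim (z≢y z≡y)
    ... | there m″ , qz = m″ , qz
  pigeonhole {Q} (c-no {x = y} {xs = ys} ¬qy c) zs u sub = pigeonhole c zs u sub′
    where
    sub′ : ∀ {z} → z ∈ zs → z ∈ ys × Q z
    sub′ m with sub m
    ... | here refl , qz = ⊥-elim (¬qy qz)
    ... | there m′ , qz  = m′ , qz

map-unique : ∀ {A B : Set} (f : A → B) (ws : List A) → Unique ws →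
             (∀ {w w′} → w ∈ ws → w′ ∈ ws → f w ≡ f w′ → w ≡ w′) → Unique (map f ws)
map-unique f []       _       _   = []
map-unique f (w ∷ ws) (h ∷ u) inj =
  All.tabulate fresh ∷ map-unique f ws u (λ m m′ → inj (there m) (there m′))
  where
  fresh : ∀ {y} → y ∈ map f ws → f w ≢ y
  fresh m fw≡y with ∈-map⁻ f m
  ... | x , x∈ , refl = All.lookup h x∈ (inj (here refl) (there x∈) fw≡y)

module _ {A B : Set} {P : A → Set} {Q : B → Set} (_≟_ : DecidableEquality B) where

  count-by-injection :
    ∀ {xs ys a b} → CountIn P xs a → CountIn Q ys b → Unique xs → (f : A → B) →
    (∀ {x} → x ∈ xs → P x → f x ∈ ys × Q (f x)) →
    (∀ {x x′} → x ∈ xs → x′ ∈ xs → P x → P x′ → f x ≡ f x′ → x ≡ x′) →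
    (extra : List B) → Unique extra → (∀ {y} → y ∈ extra → y ∈ ys × Q y) →
    (∀ {x} → x ∈ xs → P x → f x ∉ extra) →
    length extra + a ≤ b
  count-by-injection {ys = ys} {a} {b} cP cQ uxs f f-into f-inj extra u-extra extra-into disjoint =
    subst (_≤ b) length-image (pigeonhole _≟_ cQ image u-image image-into)
    where
    S = witnesses cP
    image = extra ++ map f S

    length-image : length image ≡ length extra + a
    length-image = trans (length-++ extra)
      (cong (length extra +_) (trans (length-map f S) (witnesses-length cP)))

    u-image : Unique image
    u-image = UniqueP.++⁺ u-extra
      (map-unique f S (witnesses-unique cP uxs) λ m m′ →
        let (x∈ , px) = witnesses-sound cP m ; (x′∈ , px′) = witnesses-sound cP m′
        in f-inj x∈ x′∈ px px′)
      apart
      where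
      apart : ∀ {v} → v ∈ extra × v ∈ map f S → ⊥
      apart (m₁ , m₂) with ∈-map⁻ f m₂
      ... | x , x∈ , refl = let (x∈xs , px) = witnesses-sound cP x∈ in disjoint x∈xs px m₁

    image-into : ∀ {z} → z ∈ image → z ∈ ys × Q z
    image-into m with ∈-++⁻ extra m
    ... | inj₁ m₁ = extra-into m₁
    ... | inj₂ m₂ with ∈-map⁻ f m₂
    ... | x , x∈ , refl = let (x∈xs , px) = witnesses-sound cP x∈ in f-into x∈xs px

module _ {A : Set} where

  sublist-⊆ : ∀ {es F : List A} → F ∈ sublists es → ∀ {e} → e ∈ F → e ∈ es
  sublist-⊆ {[]}     (here refl) ()
  sublist-⊆ {x ∷ es} m e∈F with ∈-++⁻ (map (x ∷_) (sublists es)) m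
  ... | inj₂ m₂ = there (sublist-⊆ m₂ e∈F)
  ... | inj₁ m₁ with ∈-map⁻ (x ∷_) m₁
  ... | F′ , m′ , refl with e∈F
  ...   | here refl = here refl
  ...   | there e∈F′ = there (sublist-⊆ m′ e∈F′)

  filter-sublist : ∀ {P : A → Set} (P? : ∀ x → Dec (P x)) es → filter P? es ∈ sublists es
  filter-sublist P? []       = here refl
  filter-sublist P? (x ∷ es) with P? x
  ... | yes _ = ∈-++⁺ˡ (∈-map⁺ (x ∷_) (filter-sublist P? es))
  ... | no _  = ∈-++⁺ʳ (map (x ∷_) (sublists es)) (filter-sublist P? es)

  sublist-ext : ∀ {es F F′ : List A} → Unique es → F ∈ sublists es → F′ ∈ sublists es →
                (∀ {e} → e ∈ F → e ∈ F′) → (∀ {e} → e ∈ F′ → e ∈ F) → F ≡ F′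
  sublist-ext {[]} _ (here refl) (here refl) _ _ = refl
  sublist-ext {x ∷ es} (x∉ ∷ u) m m′ to from
    with ∈-++⁻ (map (x ∷_) (sublists es)) m | ∈-++⁻ (map (x ∷_) (sublists es)) m′
  ... | inj₂ m₂ | inj₂ m₂′ = sublist-ext u m₂ m₂′ to from
  ... | inj₁ m₁ | inj₂ m₂′ with ∈-map⁻ (x ∷_) m₁
  ...   | _ , _ , refl = ⊥-elim (All.lookup x∉ (sublist-⊆ m₂′ (to (here refl))) refl)
  sublist-ext {x ∷ es} (x∉ ∷ u) m m′ to from | inj₂ m₂ | inj₁ m₁′ with ∈-map⁻ (x ∷_) m₁′
  ...   | _ , _ , refl = ⊥-elim (All.lookup x∉ (sublist-⊆ m₂ (from (here refl))) refl)
  sublist-ext {x ∷ es} (x∉ ∷ u) m m′ to from | inj₁ m₁ | inj₁ m₁′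
    with ∈-map⁻ (x ∷_) m₁ | ∈-map⁻ (x ∷_) m₁′
  ... | F , mF , refl | F′ , mF′ , refl = cong (x ∷_) (sublist-ext u mF mF′ (drop-x mF to) (drop-x mF′ from))
    where
    drop-x : ∀ {S T} → S ∈ sublists es → (∀ {e} → e ∈ x ∷ S → e ∈ x ∷ T) → ∀ {e} → e ∈ S → e ∈ T
    drop-x mS f e∈ with f (there e∈)
    ... | here refl = ⊥-elim (All.lookup x∉ (sublist-⊆ mS e∈) refl)
    ... | there e∈T = e∈T

  sublists-unique : ∀ {es : List A} → Unique es → Unique (sublists es)
  sublists-unique {[]}     _         = [] ∷ []
  sublists-unique {x ∷ es} (x∉ ∷ u) =
    UniqueP.++⁺ (UniqueP.map⁺ (λ e → proj₂ (∷-injective e)) (sublists-unique u)) (sublists-unique u) apart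
    where
    apart : ∀ {F} → F ∈ map (x ∷_) (sublists es) × F ∈ sublists es → ⊥
    apart (m₁ , m₂) with ∈-map⁻ (x ∷_) m₁
    ... | _ , _ , refl = All.lookup x∉ (sublist-⊆ m₂ (here refl)) refl

module _ {n : ℕ} where

  pick : Bool → Edge n → Edge n
  pick true  e       = e
  pick false (i , j) = (j , i)

  orient : (Edge n → Bool) → List (Edge n) → List (Edge n)
  orient c = map (λ e → pick (c e) e)

  orient-∈ : ∀ c es → orient c es ∈ orientations es
  orient-∈ c []            = here refl
  orient-∈ c ((i , j) ∷ es) with c (i , j)
  ... | true  = ∈-++⁺ˡ (∈-map⁺ ((i , j) ∷_) (orient-∈ c es))
  ... | false = ∈-++⁺ʳ (map ((i , j) ∷_) (orientations es)) (∈-map⁺ ((j , i) ∷_) (orient-∈ c es))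

  orientation-cases : ∀ {i j : Fin n} {es O} → O ∈ orientations ((i , j) ∷ es) →
    (Σ _ λ O′ → O ≡ (i , j) ∷ O′ × O′ ∈ orientations es) ⊎
    (Σ _ λ O′ → O ≡ (j , i) ∷ O′ × O′ ∈ orientations es)
  orientation-cases {i} {j} {es} m with ∈-++⁻ (map ((i , j) ∷_) (orientations es)) m
  ... | inj₁ m₁ with ∈-map⁻ ((i , j) ∷_) m₁
  ...   | O′ , m′ , refl = inj₁ (O′ , refl , m′)
  orientation-cases {i} {j} {es} m | inj₂ m₂ with ∈-map⁻ ((j , i) ∷_) m₂
  ...   | O′ , m′ , refl = inj₂ (O′ , refl , m′)

  orientation-covers : ∀ {es O} → O ∈ orientations es → ∀ {u v} → (u , v) ∈ es →
                       (u , v) ∈ O ⊎ (v , u) ∈ O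
  orientation-covers {(i , j) ∷ es} m e∈ with orientation-cases {i} {j} {es} m | e∈
  ... | inj₁ (_ , refl , _) | here refl = inj₁ (here refl)
  ... | inj₂ (_ , refl , _) | here refl = inj₂ (here refl)
  ... | inj₁ (_ , refl , m′) | there e∈′ = ⊎-map there there (orientation-covers m′ e∈′)
  ... | inj₂ (_ , refl , m′) | there e∈′ = ⊎-map there there (orientation-covers m′ e∈′)

  orientation-arc : ∀ {es O} → O ∈ orientations es → ∀ {a b} → (a , b) ∈ O →
                    (a , b) ∈ es ⊎ (b , a) ∈ es
  orientation-arc {[]} (here refl) ()
  orientation-arc {(i , j) ∷ es} m a∈ with orientation-cases {i} {j} {es} m | a∈
  ... | inj₁ (_ , refl , _) | here refl = inj₁ (here refl)
  ... | inj₂ (_ , refl , _) | here refl = inj₂ (here refl)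
  ... | inj₁ (_ , refl , m′) | there a∈′ = ⊎-map there there (orientation-arc m′ a∈′)
  ... | inj₂ (_ , refl , m′) | there a∈′ = ⊎-map there there (orientation-arc m′ a∈′)

  orientation-≡-orient : ∀ (c : Edge n → Bool) {es O} → O ∈ orientations es →
    (∀ {u v} → (u , v) ∈ es → (u , v) ∈ O → c (u , v) ≡ true) →
    (∀ {u v} → (u , v) ∈ es → (v , u) ∈ O → c (u , v) ≡ false) →
    O ≡ orient c es
  orientation-≡-orient c {[]} (here refl) _ _ = refl
  orientation-≡-orient c {(i , j) ∷ es} m fwd bwd with orientation-cases {i} {j} {es} m
  ... | inj₁ (O′ , refl , m′) rewrite fwd (here refl) (here refl) =
    cong ((i , j) ∷_) (orientation-≡-orient c m′ (λ e∈ a∈ → fwd (there e∈) (there a∈)) (λ e∈ a∈ → bwd (there e∈) (there a∈)))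
  ... | inj₂ (O′ , refl , m′) rewrite bwd (here refl) (here refl) =
    cong ((j , i) ∷_) (orientation-≡-orient c m′ (λ e∈ a∈ → fwd (there e∈) (there a∈)) (λ e∈ a∈ → bwd (there e∈) (there a∈)))

  pick-injective : ∀ b b′ {i j : Fin n} → i ≢ j → pick b (i , j) ≡ pick b′ (i , j) → b ≡ b′
  pick-injective true  true  _   _ = refl
  pick-injective false false _   _ = refl
  pick-injective true  false i≢j e = ⊥-elim (i≢j (cong proj₁ e))
  pick-injective false true  i≢j e = ⊥-elim (i≢j (cong proj₂ e))

  orient-injective : ∀ c c′ es → (∀ {u v} → (u , v) ∈ es → u ≢ v) → orient c es ≡ orient c′ es →
                     ∀ {e} → e ∈ es → c e ≡ c′ e
  orient-injective c c′ ((i , j) ∷ es) loop-free eq (here refl) =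
    pick-injective (c (i , j)) (c′ (i , j)) (loop-free (here refl)) (proj₁ (∷-injective eq))
  orient-injective c c′ (_ ∷ es) loop-free eq (there e∈) =
    orient-injective c c′ es (λ m → loop-free (there m)) (proj₂ (∷-injective eq)) e∈

  orient-cong : ∀ c c′ es → (∀ {e} → e ∈ es → c e ≡ c′ e) → orient c es ≡ orient c′ es
  orient-cong c c′ []       _     = refl
  orient-cong c c′ (e ∷ es) agree =
    cong₂ _∷_ (cong (λ b → pick b e) (agree (here refl))) (orient-cong c c′ es (λ m → agree (there m)))

  orientations-unique : ∀ (es : List (Edge n)) → (∀ {u v} → (u , v) ∈ es → u ≢ v) →
                        Unique (orientations es)
  orientations-unique []             _         = [] ∷ []
  orientations-unique ((i , j) ∷ es) loop-free =
    UniqueP.++⁺ (UniqueP.map⁺ tail-injective u) (UniqueP.map⁺ tail-injective u) apart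
    where
    u = orientations-unique es (λ m → loop-free (there m))
    tail-injective : ∀ {a} {O O′ : List (Edge n)} → a ∷ O ≡ a ∷ O′ → O ≡ O′
    tail-injective e = proj₂ (∷-injective e)
    apart : ∀ {O} → O ∈ map ((i , j) ∷_) (orientations es) × O ∈ map ((j , i) ∷_) (orientations es) → ⊥
    apart (m₁ , m₂) with ∈-map⁻ ((i , j) ∷_) m₁ | ∈-map⁻ ((j , i) ∷_) m₂
    ... | _ , _ , refl | _ , _ , e = loop-free (here refl) (cong proj₁ (proj₁ (∷-injective e)))

linked-trans : ∀ {A : Set} {R : A → A → Set} → (∀ {x y z} → R x y → R y z → R x z) →
               ∀ {x z} ys → Linked R (x ∷ ys ++ [ z ]) → R x z
linked-trans tr []       (r ∷ [-]) = r
linked-trans tr (y ∷ ys) (r ∷ rs)  = tr r (linked-trans tr ys rs)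

module _ {n : ℕ} {R : Fin n → Fin n → Set} where

  acyclic-by-order : (∀ {x y z} → R x y → R y z → R x z) → (∀ {x} → ¬ R x x) →
                     ∀ O → (∀ {a b} → (a , b) ∈ O → R a b) → IsAcyclic O
  acyclic-by-order R-trans R-irrefl O increasing (v ∷ vs , _ , _ , cycle) =
    R-irrefl (linked-trans R-trans vs (Linked.map increasing cycle))

  along : (∀ x y → Dec (R x y)) → Edge n → Bool
  along R? e = does (R? (proj₁ e) (proj₂ e))

  picked-increasing : ∀ R? {u v} → R u v ⊎ R v u → uncurry R (pick (along R? (u , v)) (u , v))
  picked-increasing R? {u} {v} total with R? u v | total
  ... | yes r  | _      = r
  ... | no ¬r  | inj₁ r = ⊥-elim (¬r r)
  ... | no _   | inj₂ r = r

  orient-along-increasing : ∀ R? es → (∀ {u v} → (u , v) ∈ es → R u v ⊎ R v u) →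
                            ∀ {a b} → (a , b) ∈ orient (along R?) es → R a b
  orient-along-increasing R? es total a∈ with ∈-map⁻ (λ e → pick (along R? e) e) a∈
  ... | e , e∈ , ab≡ = subst (uncurry R) (sym ab≡) (picked-increasing R? (total e∈))

  orient-along-acyclic : (∀ {x y z} → R x y → R y z → R x z) → (∀ {x} → ¬ R x x) →
                         ∀ R? es → (∀ {u v} → (u , v) ∈ es → R u v ⊎ R v u) →
                         IsAcyclic (orient (along R?) es)
  orient-along-acyclic R-trans R-irrefl R? es total =
    acyclic-by-order R-trans R-irrefl (orient (along R?) es) (orient-along-increasing R? es total)

two-cycle : ∀ {n} {O : List (Edge n)} {u v} → u ≢ v → (u , v) ∈ O → (v , u) ∈ O → HasDirCycle O
two-cycle {u = u} {v} u≢v uv vu = (u ∷ v ∷ []) , ((u≢v ∷ []) ∷ [] ∷ []) , s≤s (s≤s z≤n) , (uv ∷ vu ∷ [-])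

three-cycle : ∀ {n} {O : List (Edge n)} {u v w} → u ≢ v → u ≢ w → v ≢ w →
              (u , v) ∈ O → (v , w) ∈ O → (w , u) ∈ O → HasDirCycle O
three-cycle {u = u} {v} {w} u≢v u≢w v≢w uv vw wu =
  (u ∷ v ∷ w ∷ []) , ((u≢v ∷ u≢w ∷ []) ∷ (v≢w ∷ []) ∷ [] ∷ []) , s≤s (s≤s z≤n) , (uv ∷ vw ∷ wu ∷ [-])

orient-choice : ∀ {n} c (es : List (Edge n)) → IsAcyclic (orient c es) → ∀ {u v} → (u , v) ∈ es → u ≢ v →
                (u , v) ∈ orient c es ⇔ c (u , v) ≡ true
orient-choice c es acyclic {u} {v} uv∈ u≢v = mk⇔ to from
  where
  chosen : pick (c (u , v)) (u , v) ∈ orient c es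
  chosen = ∈-map⁺ (λ e → pick (c e) e) uv∈
  to : (u , v) ∈ orient c es → c (u , v) ≡ true
  to uv with c (u , v) in choice
  ... | true  = refl
  ... | false = ⊥-elim (acyclic (two-cycle u≢v uv (subst (λ b → pick b (u , v) ∈ orient c es) choice chosen)))
  from : c (u , v) ≡ true → (u , v) ∈ orient c es
  from choice = subst (λ b → pick b (u , v) ∈ orient c es) choice chosen

module _ {A : Set} {R : A → A → Set} where

  linked-∷ʳ : ∀ {a b} xs → Linked R (xs ∷ʳ a) → R a b → Linked R (xs ∷ʳ a ∷ʳ b)
  linked-∷ʳ []           [-]        r = r ∷ [-]
  linked-∷ʳ (x ∷ [])     (r₀ ∷ [-]) r = r₀ ∷ r ∷ [-]
  linked-∷ʳ (x ∷ y ∷ xs) (r₀ ∷ rs)  r = r₀ ∷ linked-∷ʳ (y ∷ xs) rs r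

  linked-last : ∀ {a b} xs → Linked R (xs ∷ʳ a ∷ʳ b) → R a b
  linked-last []           (r ∷ [-])     = r
  linked-last (x ∷ [])     (_ ∷ r ∷ [-]) = r
  linked-last (x ∷ y ∷ xs) (_ ∷ rs)      = linked-last (y ∷ xs) rs

  linked-suffix : ∀ pre {s} → Linked R (pre ++ s) → Linked R s
  linked-suffix []        rs = rs
  linked-suffix (x ∷ pre) rs = linked-suffix pre (Linked.tail rs)

  walk-reverse : (∀ {x y} → R x y → R y x) → ∀ x xs y → Linked R (x ∷ xs ++ [ y ]) →
                 Σ (List A) λ ys → Linked R (y ∷ ys ++ [ x ])
  walk-reverse R-sym x []       y (r ∷ [-]) = [] , (R-sym r ∷ [-])
  walk-reverse R-sym x (z ∷ zs) y (r ∷ rs) with walk-reverse R-sym z zs y rs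
  ... | ys , rs′ = (ys ∷ʳ z) , linked-∷ʳ (y ∷ ys) rs′ (R-sym r)

  walk-append : ∀ x xs y ys z → Linked R (x ∷ xs ++ [ y ]) → Linked R (y ∷ ys ++ [ z ]) →
                Linked R (x ∷ (xs ++ y ∷ ys) ++ [ z ])
  walk-append x []       y ys z (r ∷ [-]) rs′ = r ∷ rs′
  walk-append x (w ∷ xs) y ys z (r ∷ rs)  rs′ = r ∷ walk-append w xs y ys z rs rs′

unique-suffix : ∀ {A : Set} (pre : List A) {s} → Unique (pre ++ s) → Unique s
unique-suffix []        u       = u
unique-suffix (x ∷ pre) (_ ∷ u) = unique-suffix pre u

unique-∷ʳ : ∀ {A : Set} {xs : List A} {x} → Unique xs → x ∉ xs → Unique (xs ∷ʳ x)
unique-∷ʳ u x∉ = UniqueP.++⁺ u ([] ∷ []) λ { (x∈ , here refl) → x∉ x∈ }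

unique-rotate : ∀ {A : Set} {x : A} {xs} → Unique (x ∷ xs) → Unique (xs ∷ʳ x)
unique-rotate (x∉ ∷ u) = unique-∷ʳ u (λ x∈ → All.lookup x∉ x∈ refl)

lastOf : ∀ {A : Set} → A → List A → A
lastOf x []       = x
lastOf x (y ∷ ys) = lastOf y ys

lastOf-∷ʳ : ∀ {A : Set} (x : A) ys y → lastOf x (ys ∷ʳ y) ≡ y
lastOf-∷ʳ x []       y = refl
lastOf-∷ʳ x (z ∷ ys) y = lastOf-∷ʳ z ys y

lastOf-suffix : ∀ {A : Set} (pre : List A) {h t x post} → h ∷ t ≡ pre ++ x ∷ post →
                lastOf h t ≡ lastOf x post
lastOf-suffix []            refl = refl
lastOf-suffix (p ∷ [])      refl = refl
lastOf-suffix (p ∷ q ∷ pre) refl = lastOf-suffix (q ∷ pre) refl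

-- Every walk can be shortened to a duplicate-free walk with the same ends:
-- whenever the start recurs, cut the walk back to its last occurrence.
shortcut : ∀ {A : Set} (_≟_ : DecidableEquality A) {R : A → A → Set} x xs → Linked R (x ∷ xs) →
           Σ (List A) λ ys → Unique (x ∷ ys) × Linked R (x ∷ ys) × lastOf x ys ≡ lastOf x xs
shortcut _≟_ x []       _        = [] , ([] ∷ []) , [-] , refl
shortcut _≟_ {R} x (y ∷ xs) (r ∷ rs) with shortcut _≟_ y xs rs
... | zs , u , l , same-end with DecMembership._∈?_ _≟_ x (y ∷ zs)
...   | no x∉ = (y ∷ zs) , (All.tabulate (λ m x≡ → x∉ (subst (_∈ (y ∷ zs)) (sym x≡) m)) ∷ u) , (r ∷ l) , same-end
...   | yes x∈ with ∈-∃++ x∈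
...     | pre , post , eq =
  post , unique-suffix pre (subst Unique eq u) , linked-suffix pre (subst (Linked R) eq l) ,
  trans (sym (lastOf-suffix pre eq)) same-end

_≟ₑ_ : ∀ {n} → DecidableEquality (Edge n)
_≟ₑ_ = ProductP.≡-dec _≟ᶠ_ _≟ᶠ_

module _ {n : ℕ} (G : Graph n) where

  private
    is-edge : Edge n → Bool
    is-edge e = (toℕ (proj₁ e) <ᵇ toℕ (proj₂ e)) ∧ adj G (proj₁ e) (proj₂ e)

  edges-sound : ∀ {u v} → (u , v) ∈ edges G → u <ᶠ v × adj G u v ≡ true
  edges-sound {u} {v} m with ∈-filter⁻ (λ e → T? (is-edge e)) {xs = cartesianProduct (allFin n) (allFin n)} m
  ... | _ , t with Equivalence.to T-∧ t
  ...   | u<v , uv = <ᵇ⇒< (toℕ u) (toℕ v) u<v , Equivalence.to T-≡ uv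

  edges-complete : ∀ {u v} → u <ᶠ v → adj G u v ≡ true → (u , v) ∈ edges G
  edges-complete {u} {v} u<v uv =
    ∈-filter⁺ (λ e → T? (is-edge e)) (∈-cartesianProduct⁺ (∈-allFin u) (∈-allFin v))
      (Equivalence.from T-∧ (<⇒<ᵇ u<v , Equivalence.from T-≡ uv))

  edges-unique : Unique (edges G)
  edges-unique = UniqueP.filter⁺ (λ e → T? (is-edge e))
    (UniqueP.cartesianProduct⁺ (UniqueP.allFin⁺ n) (UniqueP.allFin⁺ n))

  edges-ordered : ∀ {u v} → (u , v) ∈ edges G → u <ᶠ v
  edges-ordered m = proj₁ (edges-sound m)

  edges-loop-free : ∀ {u v} → (u , v) ∈ edges G → u ≢ v
  edges-loop-free m refl = <-irrefl refl (edges-ordered m)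

UniqueParents : ∀ {n} → List (Edge n) → Set
UniqueParents F = ∀ {u u′ v} → (u , v) ∈ F → (u′ , v) ∈ F → u ≡ u′

NoBacktrack : ∀ {n} → List (Fin n) → Set
NoBacktrack (x ∷ y ∷ z ∷ r) = x ≢ z × NoBacktrack (y ∷ z ∷ r)
NoBacktrack _               = ⊤

unique⇒no-backtrack : ∀ {n} {xs : List (Fin n)} → Unique xs → NoBacktrack xs
unique⇒no-backtrack {xs = []}            _       = tt
unique⇒no-backtrack {xs = _ ∷ []}        _       = tt
unique⇒no-backtrack {xs = _ ∷ _ ∷ []}    _       = tt
unique⇒no-backtrack {xs = _ ∷ _ ∷ _ ∷ _} (h ∷ u) = All.lookup h (there (here refl)) , unique⇒no-backtrack u

EndsUp : ∀ {n} → List (Fin n) → Set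
EndsUp (a ∷ b ∷ [])    = a <ᶠ b
EndsUp (a ∷ b ∷ c ∷ r) = EndsUp (b ∷ c ∷ r)
EndsUp _               = ⊥

increasing⇒ends-up : ∀ {n} {x y : Fin n} {r} → Linked _<ᶠ_ (x ∷ y ∷ r) → EndsUp (x ∷ y ∷ r)
increasing⇒ends-up {r = []}    (x<y ∷ [-]) = x<y
increasing⇒ends-up {r = _ ∷ _} (_ ∷ rs)    = increasing⇒ends-up rs

ends-up-∷ʳ : ∀ {n} (p : List (Fin n)) {a b} → EndsUp (p ∷ʳ a ∷ʳ b) → a <ᶠ b
ends-up-∷ʳ []            a<b = a<b
ends-up-∷ʳ (_ ∷ [])      a<b = a<b
ends-up-∷ʳ (_ ∷ _ ∷ [])  a<b = a<b
ends-up-∷ʳ (_ ∷ y ∷ z ∷ p) up = ends-up-∷ʳ (y ∷ z ∷ p) up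

closed-no-backtrack : ∀ {n} {x y z : Fin n} ws → Unique (x ∷ y ∷ ws ∷ʳ z) →
                      NoBacktrack (x ∷ y ∷ (ws ∷ʳ z) ∷ʳ x)
closed-no-backtrack []      u@(x∉ ∷ _) = All.lookup x∉ (there (here refl)) , unique⇒no-backtrack (unique-rotate u)
closed-no-backtrack (_ ∷ _) u@(x∉ ∷ _) = All.lookup x∉ (there (here refl)) , unique⇒no-backtrack (unique-rotate u)

module _ {n : ℕ} (F : List (Edge n)) (ordered : ∀ {u v} → (u , v) ∈ F → u <ᶠ v) where

  fadj-up : ∀ {a b} → FAdj F a b → a <ᶠ b → (a , b) ∈ F
  fadj-up (inj₁ ab) _   = ab
  fadj-up (inj₂ ba) a<b = ⊥-elim (<-asym a<b (ordered ba))

  fadj-compare : ∀ {a b} → FAdj F a b → a <ᶠ b ⊎ b <ᶠ a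
  fadj-compare (inj₁ ab) = inj₁ (ordered ab)
  fadj-compare (inj₂ ba) = inj₂ (ordered ba)

  fadj-sym : ∀ {a b} → FAdj F a b → FAdj F b a
  fadj-sym (inj₁ ab) = inj₂ ab
  fadj-sym (inj₂ ba) = inj₁ ba

  reachable-sym : ∀ {a b} → Reachable F a b → Reachable F b a
  reachable-sym {a} {b} (ws , walk) = walk-reverse fadj-sym a ws b walk

  reachable-trans : ∀ {a b c} → Reachable F a b → Reachable F b c → Reachable F a c
  reachable-trans {a} {b} {c} (ws , walk) (ws′ , walk′) = (ws ++ b ∷ ws′) , walk-append a ws b ws′ c walk walk′

  root-has-no-parent : ∀ {r u} → IsRoot F r → (u , r) ∈ F → ⊥
  root-has-no-parent {r} {u} root ur = <-irrefl refl (<-≤-trans (ordered ur) (root u ([] , (inj₂ ur ∷ [-]))))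

  -- With unique parents a non-backtracking walk has no peak: once it goes
  -- up it keeps going up, so it either only goes down or it ends going up.
  module _ (unique-parents : UniqueParents F) where

    -- a peak x < y > z would give y the two parents x and z
    keeps-rising : ∀ {x y} ys → x <ᶠ y → NoBacktrack (x ∷ y ∷ ys) → Linked (FAdj F) (x ∷ y ∷ ys) →
                   Linked _<ᶠ_ (x ∷ y ∷ ys)
    keeps-rising []       x<y _          (_ ∷ [-])      = x<y ∷ [-]
    keeps-rising (z ∷ zs) x<y (x≢z , nb) (xy ∷ yz ∷ rs) with fadj-compare yz
    ... | inj₁ y<z = x<y ∷ keeps-rising zs y<z nb (yz ∷ rs)
    ... | inj₂ z<y = ⊥-elim (x≢z (unique-parents (fadj-up xy x<y) (fadj-up (fadj-sym yz) z<y)))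

    descends-or-ends-up : ∀ {x y} ys → NoBacktrack (x ∷ y ∷ ys) → Linked (FAdj F) (x ∷ y ∷ ys) →
                          Linked (λ a b → b <ᶠ a) (x ∷ y ∷ ys) ⊎ EndsUp (x ∷ y ∷ ys)
    descends-or-ends-up ys nb walk with fadj-compare (Linked.head walk)
    ... | inj₁ x<y = inj₂ (increasing⇒ends-up (keeps-rising ys x<y nb walk))
    descends-or-ends-up []       _        (_ ∷ [-]) | inj₂ y<x = inj₁ (y<x ∷ [-])
    descends-or-ends-up (z ∷ zs) (_ , nb) (_ ∷ rs)  | inj₂ y<x with descends-or-ends-up zs nb rs
    ... | inj₁ down = inj₁ (y<x ∷ down)
    ... | inj₂ up   = inj₂ up

    -- a cycle v₀ v₁ … z would have to rise back to v₀ after first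
    -- falling, giving v₀ the two parents v₁ and z
    unique-parents⇒forest : IsForest F
    unique-parents⇒forest (_ ∷ [] , _ , s≤s () , _)
    unique-parents⇒forest (v₀ ∷ v₁ ∷ rest , u , len , walk) with initLast rest
    unique-parents⇒forest (_ ∷ _ ∷ _ , _ , s≤s (s≤s ()) , _) | []
    ... | mid ∷ʳ′ z with fadj-compare (Linked.head walk)
    ...   | inj₁ v₀<v₁ =
      <-irrefl refl (linked-trans <-trans (v₁ ∷ mid ∷ʳ z) (keeps-rising ((mid ∷ʳ z) ∷ʳ v₀) v₀<v₁ nb walk))
      where nb = closed-no-backtrack mid u
    ...   | inj₂ v₁<v₀ with descends-or-ends-up ((mid ∷ʳ z) ∷ʳ v₀) (closed-no-backtrack mid u) walk
    ...     | inj₁ down = <-irrefl refl (linked-trans (λ p q → <-trans q p) (v₁ ∷ mid ∷ʳ z) down)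
    ...     | inj₂ up   = v₁≢z (unique-parents (fadj-up (fadj-sym (Linked.head walk)) v₁<v₀) (fadj-up z-v₀ z<v₀))
      where
      z<v₀ = ends-up-∷ʳ (v₀ ∷ v₁ ∷ mid) up
      z-v₀ = linked-last (v₀ ∷ v₁ ∷ mid) walk
      v₁≢z : v₁ ≢ z
      v₁≢z = All.lookup (AllPairs.head (AllPairs.tail u)) (∈-++⁺ʳ mid (here refl))

    -- a duplicate-free walk from the root starts upwards, hence rises
    unique-parents⇒increasing : IsIncreasing F
    unique-parents⇒increasing r []       _    _ _    = [-]
    unique-parents⇒increasing r (y ∷ ys) root u walk with fadj-compare (Linked.head walk)
    ... | inj₁ r<y = keeps-rising ys r<y (unique⇒no-backtrack u) walk
    ... | inj₂ y<r = ⊥-elim (root-has-no-parent root (fadj-up (fadj-sym (Linked.head walk)) y<r))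

    unique-parents⇒isf : IsISF F
    unique-parents⇒isf = unique-parents⇒forest , unique-parents⇒increasing

  closing-edge-cycle : ∀ {q c v} cs → Unique (q ∷ c ∷ cs ∷ʳ v) → Linked (FAdj F) (q ∷ c ∷ cs ∷ʳ v) →
                       (q , v) ∈ F → HasCycle F
  closing-edge-cycle {q} {c} {v} cs u walk qv =
    (q ∷ c ∷ cs ∷ʳ v) , u , s≤s (s≤s (subst (1 ≤_) (sym (length-++ cs)) (m≤n+m 1 (length cs)))) ,
    linked-∷ʳ (q ∷ c ∷ cs) walk (inj₂ qv)

  -- Finding the least
  -- vertex of the component is a search over a relation that need not be
  -- decidable, so the root is only obtained under a double negation.
  root-exists : ∀ {x v} → Reachable F x v → ¬ ¬ (Σ (Fin n) λ r → IsRoot F r × Reachable F r v)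
  root-exists {x} {v} = search (suc (toℕ x)) x ≤-refl
    where
    search : ∀ k x → toℕ x < k → Reachable F x v → ¬ ¬ (Σ (Fin n) λ r → IsRoot F r × Reachable F r v)
    search zero    x ()  _    _
    search (suc k) x (s≤s x≤k) x⇝v no-root = no-root (x , x-is-root , x⇝v)
      where
      x-is-root : IsRoot F x
      x-is-root w x⇝w with toℕ x ≤? toℕ w
      ... | yes x≤w = x≤w
      ... | no x≰w  = ⊥-elim (search k w (<-≤-trans (≰⇒> x≰w) x≤k)
                               (reachable-trans (reachable-sym x⇝w) x⇝v) no-root)

  module _ (isf : IsISF F) where

    -- In an ISF the only F-parent of the end v of a duplicate-free walk
    -- r … p v from a root r is p: any other parent q either extends the
    -- walk by the descent v q, or closes a cycle q … p v q.
    parent-is-predecessor : ∀ {r v q} zs → IsRoot F r → Unique (r ∷ zs ∷ʳ v) →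
                            Linked (FAdj F) (r ∷ zs ∷ʳ v) → (q , v) ∈ F → q ≡ lastOf r zs
    parent-is-predecessor {r} {v} {q} zs root u walk qv
      with DecMembership._∈?_ _≟ᶠ_ q (r ∷ zs ∷ʳ v)
    ... | no q∉ = ⊥-elim (<-asym (ordered qv) v<q)
      where
      v<q : v <ᶠ q
      v<q = linked-last (r ∷ zs) (proj₂ isf r ((zs ∷ʳ v) ∷ʳ q) root (unique-∷ʳ u q∉)
                                   (linked-∷ʳ (r ∷ zs) walk (inj₂ qv)))
    ... | yes q∈ with ∈-++⁻ (r ∷ zs) q∈
    ...   | inj₂ (here refl) = ⊥-elim (<-irrefl refl (ordered qv))
    ...   | inj₁ q∈rzs with ∈-∃++ q∈rzs
    ...     | pre , [] , split = sym (lastOf-suffix pre split)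
    ...     | pre , c ∷ cs , split = ⊥-elim (proj₁ isf (closing-edge-cycle cs
                (unique-suffix pre (subst Unique suffix u)) (linked-suffix pre (subst (Linked (FAdj F)) suffix walk)) qv))
      where
      suffix : (r ∷ zs) ∷ʳ v ≡ pre ++ (q ∷ c ∷ cs ∷ʳ v)
      suffix = trans (cong (_∷ʳ v) split) (++-assoc pre (q ∷ c ∷ cs) [ v ])

    -- both parents of v are the predecessor of v on a simple walk from a root
    parents-agree : ∀ {r v u u′} → IsRoot F r → Reachable F r v → (u , v) ∈ F → (u′ , v) ∈ F → u ≡ u′
    parents-agree {r} {v} {u} {u′} root (ws , walk) uv u′v with shortcut _≟ᶠ_ r (ws ∷ʳ v) walk
    ... | ys , uniq , simple , same-end with initLast ys
    ...   | [] = ⊥-elim (root-has-no-parent root (subst (λ x → (u , x) ∈ F) (sym r≡v) uv))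
      where r≡v = trans same-end (lastOf-∷ʳ r ws v)
    ...   | zs ∷ʳ′ w with trans (sym (lastOf-∷ʳ r zs w)) (trans same-end (lastOf-∷ʳ r ws v))
    ...     | refl = trans (parent-is-predecessor zs root uniq simple uv)
                           (sym (parent-is-predecessor zs root uniq simple u′v))

    -- conversely, in an ISF the parents of v agree: some root reaches v,
    -- and on a simple walk from it both are the predecessor of v
    isf⇒unique-parents : UniqueParents F
    isf⇒unique-parents {u} {u′} {v} uv u′v = decidable-stable (u ≟ᶠ u′) λ u≢u′ →
      root-exists ([] , (inj₁ uv ∷ [-])) λ (r , root , r⇝v) → u≢u′ (parents-agree root r⇝v uv u′v)

-- Keys
-- of vertices (root-to-vertex label sequences) ordered this way give the
-- acyclic orientation attached to a forest.

infix 4 _≺_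
data _≺_ : List ℕ → List ℕ → Set where
  prefix≺ : ∀ {y ys}        → [] ≺ y ∷ ys
  head≺   : ∀ {x y xs ys}   → y < x → x ∷ xs ≺ y ∷ ys
  tail≺   : ∀ {x xs ys}     → xs ≺ ys → x ∷ xs ≺ x ∷ ys

≺-irrefl : ∀ {xs} → ¬ xs ≺ xs
≺-irrefl (head≺ x<x)  = <-irrefl refl x<x
≺-irrefl (tail≺ xs≺xs) = ≺-irrefl xs≺xs

≺-trans : ∀ {xs ys zs} → xs ≺ ys → ys ≺ zs → xs ≺ zs
≺-trans prefix≺     (head≺ _)   = prefix≺
≺-trans prefix≺     (tail≺ _)   = prefix≺
≺-trans (head≺ p)   (head≺ q)   = head≺ (<-trans q p)
≺-trans (head≺ p)   (tail≺ _)   = head≺ p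
≺-trans (tail≺ _)   (head≺ q)   = head≺ q
≺-trans (tail≺ p)   (tail≺ q)   = tail≺ (≺-trans p q)

≺-asym : ∀ {xs ys} → xs ≺ ys → ¬ ys ≺ xs
≺-asym p q = ≺-irrefl (≺-trans p q)

data Comparison (xs ys : List ℕ) : Set where
  less    : xs ≺ ys → Comparison xs ys
  equal   : xs ≡ ys → Comparison xs ys
  greater : ys ≺ xs → Comparison xs ys

compare : ∀ xs ys → Comparison xs ys
compare []       []       = equal refl
compare []       (_ ∷ _)  = less prefix≺
compare (_ ∷ _)  []       = greater prefix≺
compare (x ∷ xs) (y ∷ ys) with <-cmp x y
... | tri< x<y _ _ = greater (head≺ x<y)
... | tri> _ _ y<x = less (head≺ y<x)
... | tri≈ _ refl _ with compare xs ys
...   | less p    = less (tail≺ p)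
...   | equal refl = equal refl
...   | greater p = greater (tail≺ p)

_≺?_ : ∀ xs ys → Dec (xs ≺ ys)
xs ≺? ys with compare xs ys
... | less p     = yes p
... | equal refl = no ≺-irrefl
... | greater p  = no (≺-asym p)

≺-++ : ∀ {xs ys} zs → xs ≺ ys → xs ≺ ys ++ zs
≺-++ zs prefix≺   = prefix≺
≺-++ zs (head≺ p) = head≺ p
≺-++ zs (tail≺ p) = tail≺ (≺-++ zs p)

≺-extension : ∀ xs {z zs} → xs ≺ xs ++ z ∷ zs
≺-extension []       = prefix≺
≺-extension (x ∷ xs) = tail≺ (≺-extension xs)

≺-∷ʳ : ∀ {xs ys k} → xs ≺ ys → All (_< k) ys → xs ∷ʳ k ≺ ys
≺-∷ʳ prefix≺   (k>y ∷ _) = head≺ k>y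
≺-∷ʳ (head≺ p) _         = head≺ p
≺-∷ʳ (tail≺ p) (_ ∷ ys<k) = tail≺ (≺-∷ʳ p ys<k)

≺-∷ʳ⁻ : ∀ {xs ys k} → All (_< k) ys → ys ≺ xs ∷ʳ k → ys ≡ xs ⊎ ys ≺ xs
≺-∷ʳ⁻ {xs} {ys} ys<k ys≺ with compare ys xs
... | less p    = inj₂ p
... | equal e   = inj₁ e
... | greater p = ⊥-elim (≺-asym ys≺ (≺-∷ʳ p ys<k))

-- Parent functions.  A forest is recorded by the parent of each vertex
-- (nothing for roots); parents are smaller than their children.

ParentFn : ℕ → Set
ParentFn n = Fin n → Maybe (Fin n)

module _ {n : ℕ} where

  Decreasing : ParentFn n → Set
  Decreasing π = ∀ v u → π v ≡ just u → u <ᶠ v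

  -- The key of v lists the labels on the path from its root down to v.
  -- The recursion follows parents, which decrease, so toℕ v + 1 steps of
  -- fuel suffice.
  keyWithin : ℕ → ParentFn n → Fin n → List ℕ
  keyWithin zero    π v = []
  keyWithin (suc f) π v with π v
  ... | nothing = [ toℕ v ]
  ... | just u  = keyWithin f π u ∷ʳ toℕ v

  key : ParentFn n → Fin n → List ℕ
  key π v = keyWithin (suc (toℕ v)) π v

  module _ {π : ParentFn n} (dec : Decreasing π) where

    keyWithin-fuel : ∀ f f′ v → toℕ v < f → toℕ v < f′ → keyWithin f π v ≡ keyWithin f′ π v
    keyWithin-fuel (suc f) (suc f′) v (s≤s v≤f) (s≤s v≤f′) with π v in e
    ... | nothing = refl
    ... | just u  = cong (_∷ʳ toℕ v) (keyWithin-fuel f f′ u (<-≤-trans (dec v u e) v≤f) (<-≤-trans (dec v u e) v≤f′))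

    key-child : ∀ {v u} → π v ≡ just u → key π v ≡ key π u ∷ʳ toℕ v
    key-child {v} {u} e rewrite e = cong (_∷ʳ toℕ v) (keyWithin-fuel (toℕ v) (suc (toℕ u)) u (dec v u e) ≤-refl)

    keyWithin-bounded : ∀ f v → All (_≤ toℕ v) (keyWithin f π v)
    keyWithin-bounded zero    v = []
    keyWithin-bounded (suc f) v with π v in e
    ... | nothing = ≤-refl ∷ []
    ... | just u  = ++⁺ (All.map (λ w≤u → ≤-trans w≤u (<⇒≤ (dec v u e))) (keyWithin-bounded f u)) (≤-refl ∷ [])

    key-below : ∀ {v k} → toℕ v < k → All (_< k) (key π v)
    key-below {v} v<k = All.map (λ w≤v → ≤-<-trans w≤v v<k) (keyWithin-bounded (suc (toℕ v)) v)

    key-local : ∀ {π′} v → (∀ w → toℕ w ≤ toℕ v → π w ≡ π′ w) → key π v ≡ key π′ v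
    key-local {π′} v agree = within (suc (toℕ v)) v agree
      where
      within : ∀ f v → (∀ w → toℕ w ≤ toℕ v → π w ≡ π′ w) → keyWithin f π v ≡ keyWithin f π′ v
      within zero    v _     = refl
      within (suc f) v agree with π v in e | π′ v in e′ | agree v ≤-refl
      ... | nothing | nothing | _    = refl
      ... | just u  | just .u | refl =
        cong (_∷ʳ toℕ v) (within f u λ w w≤u → agree w (≤-trans w≤u (<⇒≤ (dec v u e))))

  key-root : ∀ {π v} → π v ≡ nothing → key π v ≡ [ toℕ v ]
  key-root {π} {v} e rewrite e = refl

  key-last : ∀ π v → Σ (List ℕ) λ ks → key π v ≡ ks ∷ʳ toℕ v
  key-last π v with π v
  ... | nothing = [] , refl
  ... | just u  = keyWithin (toℕ v) π u , refl

  key-injective : ∀ π {u v} → key π u ≡ key π v → u ≡ v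
  key-injective π {u} {v} e with key-last π u | key-last π v
  ... | ks , eu | ks′ , ev = toℕ-injective (∷ʳ-injectiveʳ ks ks′ (trans (sym eu) (trans e ev)))

  key-distinct : ∀ π {u v} → u ≢ v → key π u ≺ key π v ⊎ key π v ≺ key π u
  key-distinct π {u} {v} u≢v with compare (key π u) (key π v)
  ... | less p    = inj₁ p
  ... | equal e   = ⊥-elim (u≢v (key-injective π e))
  ... | greater p = inj₂ p

  []≺key : ∀ π v → [] ≺ key π v
  []≺key π v with key-last π v
  ... | []    , e = subst ([] ≺_) (sym e) prefix≺
  ... | _ ∷ _ , e = subst ([] ≺_) (sym e) prefix≺

  root-precedes : ∀ {π} → Decreasing π → ∀ {u v} → π v ≡ nothing → u <ᶠ v → key π v ≺ key π u
  root-precedes {π} dec {u} {v} root u<v =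
    subst (_≺ key π u) (sym (key-root {π} root)) (≺-∷ʳ ([]≺key π u) (key-below dec u<v))

  key-maximum : ∀ π (x : Fin n) xs → Σ (Fin n) λ p → p ∈ x ∷ xs ×
                (∀ {w} → w ∈ x ∷ xs → w ≡ p ⊎ key π w ≺ key π p)
  key-maximum π x [] = x , here refl , λ { (here refl) → inj₁ refl }
  key-maximum π x (y ∷ ys) with key-maximum π y ys
  ... | p , p∈ , p-max with compare (key π x) (key π p)
  ...   | less x≺p    = p , there p∈ , λ { (here refl) → inj₂ x≺p ; (there w∈) → p-max w∈ }
  ...   | equal x≡p   = p , there p∈ , λ { (here refl) → inj₁ (key-injective π x≡p) ; (there w∈) → p-max w∈ }
  ...   | greater p≺x = x , here refl , λ { (here refl) → inj₁ refl ; (there w∈) → below-x (p-max w∈) }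
    where
    below-x : ∀ {w} → w ≡ p ⊎ key π w ≺ key π p → w ≡ x ⊎ key π w ≺ key π x
    below-x (inj₁ refl) = inj₂ p≺x
    below-x (inj₂ w≺p)  = inj₂ (≺-trans w≺p p≺x)

module _ {n : ℕ} (G : Graph n) where

  InGraph : ParentFn n → Set
  InGraph π = ∀ v p → π v ≡ just p → (p , v) ∈ edges G

  inGraph⇒decreasing : ∀ {π} → InGraph π → Decreasing π
  inGraph⇒decreasing inG v p e = edges-ordered G (inG v p e)

  keyChoice : ParentFn n → Edge n → Bool
  keyChoice π = along (λ a b → key π a ≺? key π b)

  keyOrientation : ParentFn n → List (Edge n)
  keyOrientation π = orient (keyChoice π) (edges G)

  -- keys are distinct and ≺ is a strict order, so it is acyclic
  keyOrientation-acyclic : ∀ π → IsAcyclic (keyOrientation π)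
  keyOrientation-acyclic π =
    orient-along-acyclic ≺-trans ≺-irrefl (λ a b → key π a ≺? key π b) (edges G)
      (λ e∈ → key-distinct π (edges-loop-free G e∈))

  keyChoice-true : ∀ π {a b} → key π a ≺ key π b → keyChoice π (a , b) ≡ true
  keyChoice-true π {a} {b} = dec-true (key π a ≺? key π b)

  keyChoice-false : ∀ π {a b} → ¬ key π a ≺ key π b → keyChoice π (a , b) ≡ false
  keyChoice-false π {a} {b} = dec-false (key π a ≺? key π b)

  keyChoice-sound : ∀ π {a b} → keyChoice π (a , b) ≡ true → key π a ≺ key π b
  keyChoice-sound π {a} {b} e with key π a ≺? key π b
  ... | yes a≺b = a≺b

  module _ {π : ParentFn n} (dec : Decreasing π) {v : Fin n} where

    parent-arc-in : ∀ {p} → π v ≡ just p → keyChoice π (p , v) ≡ true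
    parent-arc-in {p} e = keyChoice-true π (subst (key π p ≺_) (sym (key-child dec e)) (≺-extension (key π p)))

    root-arcs-out : π v ≡ nothing → ∀ {x} → x <ᶠ v → keyChoice π (x , v) ≡ false
    root-arcs-out root x<v = keyChoice-false π (≺-asym (root-precedes dec root x<v))

    later-arcs-out : ∀ {p x} → π v ≡ just p → x <ᶠ v → key π p ≺ key π x → keyChoice π (x , v) ≡ false
    later-arcs-out {p} {x} e x<v p≺x = keyChoice-false π λ x≺v →
      ≺-asym (subst (key π x ≺_) (key-child dec e) x≺v) (≺-∷ʳ p≺x (key-below dec x<v))

  private
    conflict : ∀ {a b : Bool} → a ≡ true → a ≡ b → b ≡ false → ⊥
    conflict refl refl ()

  -- The parent of v is recovered from the arcs at v and the keys of the
  -- vertices below v: it is the in-neighbour below v that comes last.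
  parent-recovered : ∀ {π π′} → InGraph π → InGraph π′ → ∀ v →
    (∀ x → x <ᶠ v → key π x ≡ key π′ x) →
    (∀ {u} → (u , v) ∈ edges G → keyChoice π (u , v) ≡ keyChoice π′ (u , v)) →
    π v ≡ π′ v
  parent-recovered {π} {π′} inG inG′ v same-keys same-arcs = recover (π v) (π′ v) refl refl
    where
    dec = inGraph⇒decreasing inG
    dec′ = inGraph⇒decreasing inG′
    recover : ∀ a a′ → π v ≡ a → π′ v ≡ a′ → a ≡ a′
    recover nothing  nothing   _ _  = refl
    recover (just p) nothing   e e′ = ⊥-elim (conflict (parent-arc-in dec e) (same-arcs (inG v p e))
                                                 (root-arcs-out dec′ e′ (edges-ordered G (inG v p e))))
    recover nothing  (just p′) e e′ = ⊥-elim (conflict (parent-arc-in dec′ e′) (sym (same-arcs (inG′ v p′ e′)))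
                                                 (root-arcs-out dec e (edges-ordered G (inG′ v p′ e′))))
    recover (just p) (just p′) e e′ with p ≟ᶠ p′
    ... | yes refl = refl
    ... | no p≢p′ with key-distinct π p≢p′
    ...   | inj₁ p≺p′ = ⊥-elim (conflict (parent-arc-in dec′ e′) (sym (same-arcs (inG′ v p′ e′)))
                                  (later-arcs-out dec e p′<v p≺p′))
      where p′<v = edges-ordered G (inG′ v p′ e′)
    ...   | inj₂ p′≺p = ⊥-elim (conflict (parent-arc-in dec e) (same-arcs (inG v p e))
                                  (later-arcs-out dec′ e′ p<v (subst₂ _≺_ (same-keys p′ p′<v) (same-keys p p<v) p′≺p)))
      where
      p<v = edges-ordered G (inG v p e)
      p′<v = edges-ordered G (inG′ v p′ e′)

  parents-determined : ∀ K {π π′} → InGraph π → InGraph π′ →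
    (∀ {u v} → (u , v) ∈ edges G → toℕ v < K → keyChoice π (u , v) ≡ keyChoice π′ (u , v)) →
    ∀ w → toℕ w < K → π w ≡ π′ w
  parents-determined K {π} {π′} inG inG′ same-arcs w = induct (suc (toℕ w)) w ≤-refl
    where
    induct : ∀ m v → toℕ v < m → toℕ v < K → π v ≡ π′ v
    induct (suc m) v (s≤s v≤m) v<K = parent-recovered inG inG′ v same-keys (λ e∈ → same-arcs e∈ v<K)
      where
      same-keys : ∀ x → x <ᶠ v → key π x ≡ key π′ x
      same-keys x x<v = key-local (inGraph⇒decreasing inG) x λ y y≤x →
        induct m y (≤-<-trans y≤x (<-≤-trans x<v v≤m)) (≤-<-trans y≤x (<-trans x<v v<K))

module _ {n : ℕ} where

  parentOf : List (Edge n) → ParentFn n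
  parentOf []            v = nothing
  parentOf ((a , b) ∷ F) v with b ≟ᶠ v
  ... | yes _ = just a
  ... | no _  = parentOf F v

  parentOf-sound : ∀ F {v u} → parentOf F v ≡ just u → (u , v) ∈ F
  parentOf-sound ((a , b) ∷ F) {v} e with b ≟ᶠ v
  parentOf-sound ((a , b) ∷ F) refl | yes refl = here refl
  ... | no _ = there (parentOf-sound F e)

  parentOf-complete : ∀ F {u v} → UniqueParents F → (u , v) ∈ F → parentOf F v ≡ just u
  parentOf-complete ((a , b) ∷ F) {u} {v} unique-parents uv with b ≟ᶠ v
  ... | yes refl = cong just (unique-parents (here refl) uv)
  ... | no b≢v with uv
  ...   | here refl = ⊥-elim (b≢v refl)
  ...   | there uv′ = parentOf-complete F (λ m m′ → unique-parents (there m) (there m′)) uv′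

module _ {n : ℕ} (G : Graph n) where

  parentOf-inGraph : ∀ F → (∀ {e} → e ∈ F → e ∈ edges G) → InGraph G (parentOf F)
  parentOf-inGraph F F⊆ v p e = F⊆ (parentOf-sound F e)

  private
    has-parent? : ∀ (π : ParentFn n) (e : Edge n) → Dec (π (proj₂ e) ≡ just (proj₁ e))
    has-parent? π e = MaybeP.≡-dec _≟ᶠ_ (π (proj₂ e)) (just (proj₁ e))

  forestOf : ParentFn n → List (Edge n)
  forestOf π = filter (has-parent? π) (edges G)

  forestOf-sound : ∀ π {u v} → (u , v) ∈ forestOf π → (u , v) ∈ edges G × π v ≡ just u
  forestOf-sound π = ∈-filter⁻ (has-parent? π)

  forestOf-complete : ∀ π → InGraph G π → ∀ {u v} → π v ≡ just u → (u , v) ∈ forestOf π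
  forestOf-complete π inG {u} {v} e = ∈-filter⁺ (has-parent? π) (inG v u e) e

  forestOf-sublist : ∀ π → forestOf π ∈ sublists (edges G)
  forestOf-sublist π = filter-sublist (has-parent? π) (edges G)

  forestOf-isf : ∀ π → IsISF (forestOf π)
  forestOf-isf π = unique-parents⇒isf (forestOf π) ordered unique-parents
    where
    ordered : ∀ {u v} → (u , v) ∈ forestOf π → u <ᶠ v
    ordered m = edges-ordered G (proj₁ (forestOf-sound π m))
    unique-parents : UniqueParents (forestOf π)
    unique-parents m m′ = just-injective (trans (sym (proj₂ (forestOf-sound π m))) (proj₂ (forestOf-sound π m′)))

  forestOf-injective : ∀ {π π′} → InGraph G π → InGraph G π′ → forestOf π ≡ forestOf π′ → ∀ v → π v ≡ π′ v
  forestOf-injective {π} {π′} inG inG′ same v = compare-at (π v) (π′ v) refl refl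
    where
    compare-at : ∀ a a′ → π v ≡ a → π′ v ≡ a′ → π v ≡ π′ v
    compare-at (just p) _ e _ =
      trans e (sym (proj₂ (forestOf-sound π′ (subst ((p , v) ∈_) same (forestOf-complete π inG e)))))
    compare-at nothing (just p′) e e′
      with trans (sym e) (proj₂ (forestOf-sound π (subst ((p′ , v) ∈_) (sym same) (forestOf-complete π′ inG′ e′))))
    ... | ()
    compare-at nothing nothing e e′ = trans e (sym e′)

  keyOrientation-cong : ∀ {π π′} → Decreasing π → (∀ v → π v ≡ π′ v) → keyOrientation G π ≡ keyOrientation G π′
  keyOrientation-cong {π} {π′} dec same = orient-cong (keyChoice G π) (keyChoice G π′) (edges G) λ {(a , b)} _ →
    cong₂ (λ ka kb → does (ka ≺? kb)) (key-local dec a (λ w _ → same w)) (key-local dec b (λ w _ → same w))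

-- First count: every ISF F of G yields the acyclic orientation
-- keyOrientation (parentOf F), and distinct ISFs yield distinct
-- orientations.

_≟ₗ_ : ∀ {n} → DecidableEquality (List (Edge n))
_≟ₗ_ = ListP.≡-dec _≟ₑ_

module _ {n : ℕ} (G : Graph n) where

  orientationOf : List (Edge n) → List (Edge n)
  orientationOf F = keyOrientation G (parentOf F)

  -- equal orientations force equal parent functions (parents-determined),
  -- and an ISF is read off from its parent function
  orientationOf-injective : ∀ {F F′} → F ∈ sublists (edges G) → F′ ∈ sublists (edges G) →
    IsISF F → IsISF F′ → orientationOf F ≡ orientationOf F′ → F ≡ F′
  orientationOf-injective {F} {F′} F∈ F′∈ isf isf′ same =
    sublist-ext (edges-unique G) F∈ F′∈ (transfer F F′ F∈ isf same-parents) (transfer F′ F F′∈ isf′ (λ v → sym (same-parents v)))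
    where
    inG : ∀ {H} → H ∈ sublists (edges G) → InGraph G (parentOf H)
    inG {H} H∈ = parentOf-inGraph G H (sublist-⊆ H∈)
    same-parents : ∀ v → parentOf F v ≡ parentOf F′ v
    same-parents v = parents-determined G n (inG F∈) (inG F′∈)
      (λ e∈ _ → orient-injective (keyChoice G (parentOf F)) (keyChoice G (parentOf F′)) (edges G)
                  (edges-loop-free G) same e∈)
      v (toℕ<n v)
    transfer : ∀ H H′ → H ∈ sublists (edges G) → IsISF H → (∀ v → parentOf H v ≡ parentOf H′ v) →
            ∀ {e} → e ∈ H → e ∈ H′
    transfer H H′ H∈ isfH same {u , v} uv = parentOf-sound H′ (trans (sym (same v))
      (parentOf-complete H (isf⇒unique-parents H ordered isfH) uv))
      where
      ordered : ∀ {a b} → (a , b) ∈ H → a <ᶠ b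
      ordered m = edges-ordered G (sublist-⊆ H∈ m)

  isf+missed≤ao : ∀ {a b} → isf≡ G a → ao≡ G b →
    (missed : List (List (Edge n))) → Unique missed →
    (∀ {O} → O ∈ missed → O ∈ orientations (edges G) × IsAcyclic O) →
    (∀ {O} → O ∈ missed → ∀ π → InGraph G π → keyOrientation G π ≢ O) →
    length missed + a ≤ b
  isf+missed≤ao count-isf count-ao missed u-missed missed-acyclic missed-new =
    count-by-injection _≟ₗ_ count-isf count-ao (sublists-unique (edges-unique G)) orientationOf
      (λ {F} _ _ → orient-∈ (keyChoice G (parentOf F)) (edges G) , keyOrientation-acyclic G (parentOf F))
      (λ F∈ F′∈ → orientationOf-injective F∈ F′∈)
      missed u-missed missed-acyclic
      (λ {F} F∈ _ O∈ → missed-new O∈ (parentOf F) (parentOf-inGraph G F (sublist-⊆ F∈)) refl)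

-- Second count: if 1,…,n is a perfect elimination ordering, every acyclic
-- orientation O is a key orientation.  Its parent function sends v to the
-- lower in-neighbour of v that all other lower in-neighbours point to.

PEOBelow : ∀ {n} → Graph n → ℕ → Set
PEOBelow {n} G K = ∀ (i j k : Fin n) → i <ᶠ j → j <ᶠ k → toℕ k < K →
  adj G i k ≡ true → adj G j k ≡ true → adj G i j ≡ true

module _ {n : ℕ} (O : List (Edge n)) where

  LowerIn : Fin n → Fin n → Set
  LowerIn v w = (w , v) ∈ O × w <ᶠ v

  lowerIn? : ∀ v w → Dec (LowerIn v w)
  lowerIn? v w = DecMembership._∈?_ _≟ₑ_ (w , v) O ×-dec (toℕ w <? toℕ v)

  IsSink : Fin n → Fin n → Set
  IsSink v p = LowerIn v p × (∀ w → LowerIn v w → w ≢ p → (w , p) ∈ O)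

  isSink? : ∀ v p → Dec (IsSink v p)
  isSink? v p = lowerIn? v p ×-dec all? λ w →
    lowerIn? v w →-dec (¬? (w ≟ᶠ p) →-dec DecMembership._∈?_ _≟ₑ_ (w , p) O)

  private
    witness : ∀ {P : Fin n → Set} → Dec (∃ P) → Maybe (Fin n)
    witness (yes (p , _)) = just p
    witness (no _)        = nothing

    witness-just : ∀ {P : Fin n → Set} (d : Dec (∃ P)) {p} → witness d ≡ just p → P p
    witness-just (yes (_ , q)) refl = q

    witness-nothing : ∀ {P : Fin n → Set} (d : Dec (∃ P)) → witness d ≡ nothing → ¬ ∃ P
    witness-nothing (no ¬p) refl = ¬p

  sinkParent : ParentFn n
  sinkParent v = witness (any? (isSink? v))

  sinkParent-just : ∀ {v p} → sinkParent v ≡ just p → IsSink v p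
  sinkParent-just {v} = witness-just (any? (isSink? v))

  sinkParent-nothing : ∀ {v} → sinkParent v ≡ nothing → ¬ ∃ (IsSink v)
  sinkParent-nothing {v} = witness-nothing (any? (isSink? v))

module _ {n : ℕ} (G : Graph n) {O : List (Edge n)} (O∈ : O ∈ orientations (edges G)) (acyclic : IsAcyclic O) where

  arc-edge : ∀ {a b} → (a , b) ∈ O → a <ᶠ b → (a , b) ∈ edges G
  arc-edge ab a<b with orientation-arc O∈ ab
  ... | inj₁ e∈ = e∈
  ... | inj₂ e∈ = ⊥-elim (<-asym a<b (edges-ordered G e∈))

  lowerIn-adj : ∀ {v w} → LowerIn O v w → adj G w v ≡ true
  lowerIn-adj (wv , w<v) = proj₂ (edges-sound G (arc-edge wv w<v))

  sinkParent-inGraph : InGraph G (sinkParent O)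
  sinkParent-inGraph v p e = let ((pv , p<v) , _) = sinkParent-just O e in arc-edge pv p<v

  no-opposite-arcs : ∀ {a b} → (a , b) ∈ O → (b , a) ∈ O → ⊥
  no-opposite-arcs {a} {b} ab ba = acyclic (two-cycle a≢b ab ba)
    where
    a≢b : a ≢ b
    a≢b refl with orientation-arc O∈ ab
    ... | inj₁ e∈ = edges-loop-free G e∈ refl
    ... | inj₂ e∈ = edges-loop-free G e∈ refl

  private
    π = sinkParent O
    dec = inGraph⇒decreasing G sinkParent-inGraph

  Agrees : Fin n → Fin n → Set
  Agrees a b = ((a , b) ∈ O → key π a ≺ key π b) × (key π a ≺ key π b → (a , b) ∈ O)

  module _ (K : ℕ) (peo : PEOBelow G K) where

    module AtVertex (v : Fin n) (v<K : toℕ v < K)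
                    (ih : ∀ {a b} → (a , b) ∈ edges G → b <ᶠ v → Agrees a b) where

      -- two lower neighbours of v are joined by an edge ending below v
      neighbours-agree : ∀ {a b} → a <ᶠ v → b <ᶠ v → adj G a v ≡ true → adj G b v ≡ true → a ≢ b →
                         Agrees a b
      neighbours-agree {a} {b} a<v b<v av bv a≢b with <-cmp (toℕ a) (toℕ b)
      ... | tri≈ _ a≡b _ = ⊥-elim (a≢b (toℕ-injective a≡b))
      ... | tri< a<b _ _ = ih (edges-complete G a<b (peo a b v a<b b<v v<K av bv)) b<v
      ... | tri> _ _ b<a = to , from
        where
        ba∈ = edges-complete G b<a (peo b a v b<a a<v v<K bv av)
        agrees-ba = ih ba∈ a<v
        to : (a , b) ∈ O → key π a ≺ key π b
        to ab with key-distinct π a≢b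
        ... | inj₁ a≺b = a≺b
        ... | inj₂ b≺a = ⊥-elim (no-opposite-arcs ab (proj₂ agrees-ba b≺a))
        from : key π a ≺ key π b → (a , b) ∈ O
        from a≺b with orientation-covers O∈ ba∈
        ... | inj₁ ba = ⊥-elim (≺-asym a≺b (proj₁ agrees-ba ba))
        ... | inj₂ ab = ab

      lower-in-agree : ∀ {a b} → LowerIn O v a → LowerIn O v b → a ≢ b → Agrees a b
      lower-in-agree ina@(_ , a<v) inb@(_ , b<v) = neighbours-agree a<v b<v (lowerIn-adj ina) (lowerIn-adj inb)

      -- the key-last lower in-neighbour is a sink
      sink-exists : ∀ {u} → LowerIn O v u → ∃ (IsSink O v)
      sink-exists {u} inu with key-maximum π u (filter (lowerIn? O v) (allFin n))
      ... | p , p∈ , p-max = p , inp , sink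
        where
        lower-in : ∀ {w} → w ∈ u ∷ filter (lowerIn? O v) (allFin n) → LowerIn O v w
        lower-in (here refl) = inu
        lower-in (there w∈)  = proj₂ (∈-filter⁻ (lowerIn? O v) {xs = allFin n} w∈)
        inp = lower-in p∈
        sink : ∀ w → LowerIn O v w → w ≢ p → (w , p) ∈ O
        sink w inw w≢p with p-max (there (∈-filter⁺ (lowerIn? O v) (∈-allFin w) inw))
        ... | inj₁ w≡p = ⊥-elim (w≢p w≡p)
        ... | inj₂ w≺p = proj₂ (lower-in-agree inw inp w≢p) w≺p

      root-agrees : π v ≡ nothing → ∀ {u} → (u , v) ∈ edges G → Agrees u v
      root-agrees root {u} uv∈ =
        (λ uv → ⊥-elim (sinkParent-nothing O root (sink-exists (uv , u<v)))) ,
        (λ u≺v → ⊥-elim (≺-asym u≺v (root-precedes dec root u<v)))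
        where u<v = edges-ordered G uv∈

      -- a vertex with parent p: the arcs into v come from p and from the
      -- vertices before p, exactly those whose keys precede key p ∷ʳ v
      child-agrees : ∀ {p} → π v ≡ just p → ∀ {u} → (u , v) ∈ edges G → Agrees u v
      child-agrees {p} e {u} uv∈ = to , from
        where
        u<v = edges-ordered G uv∈
        p-in : LowerIn O v p
        p-in = proj₁ (sinkParent-just O e)
        into-p : ∀ w → LowerIn O v w → w ≢ p → (w , p) ∈ O
        into-p = proj₂ (sinkParent-just O e)
        key-v : key π v ≡ key π p ∷ʳ toℕ v
        key-v = key-child dec e
        to : (u , v) ∈ O → key π u ≺ key π v
        to uv with u ≟ᶠ p
        ... | yes refl = subst (key π u ≺_) (sym key-v) (≺-extension (key π u))
        ... | no u≢p   = subst (key π u ≺_) (sym key-v)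
                           (≺-++ [ toℕ v ] (proj₁ (lower-in-agree (uv , u<v) p-in u≢p) (into-p u (uv , u<v) u≢p)))
        from : key π u ≺ key π v → (u , v) ∈ O
        from u≺v with ≺-∷ʳ⁻ (key-below dec u<v) (subst (key π u ≺_) key-v u≺v)
        ... | inj₁ same-key with key-injective π same-key
        ...   | refl = proj₁ p-in
        from u≺v | inj₂ u≺p with u ≟ᶠ p
        ... | yes refl = ⊥-elim (≺-irrefl u≺p)
        ... | no u≢p with orientation-covers O∈ uv∈
        ...   | inj₁ uv = uv
        ...   | inj₂ vu = ⊥-elim (acyclic (three-cycle u≢p (λ u≡v → <-irrefl (cong toℕ u≡v) u<v)
                                  (λ p≡v → <-irrefl (cong toℕ p≡v) (proj₂ p-in)) up (proj₁ p-in) vu))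
          where
          up = proj₂ (neighbours-agree u<v (proj₂ p-in) (proj₂ (edges-sound G uv∈)) (lowerIn-adj p-in) u≢p) u≺p

      agrees-at : ∀ {u} → (u , v) ∈ edges G → Agrees u v
      agrees-at = by-parent (π v) refl
        where
        by-parent : ∀ r → π v ≡ r → ∀ {u} → (u , v) ∈ edges G → Agrees u v
        by-parent nothing  e = root-agrees e
        by-parent (just p) e = child-agrees e

    agrees-below : ∀ v → toℕ v < K → ∀ {u} → (u , v) ∈ edges G → Agrees u v
    agrees-below w = induct (suc (toℕ w)) w ≤-refl
      where
      induct : ∀ m v → toℕ v < m → toℕ v < K → ∀ {u} → (u , v) ∈ edges G → Agrees u v
      induct (suc m) v (s≤s v≤m) v<K = AtVertex.agrees-at v v<K
        λ {a} {b} ab∈ b<v → induct m b (<-≤-trans b<v v≤m) (<-trans b<v v<K) ab∈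

module _ {n : ℕ} (G : Graph n) (peo : PEOBelow G n) where

  acyclic⇒keyOrientation : ∀ {O} → O ∈ orientations (edges G) → IsAcyclic O →
                           O ≡ keyOrientation G (sinkParent O)
  acyclic⇒keyOrientation {O} O∈ acyclic = orientation-≡-orient (keyChoice G π) O∈
    (λ {u} {v} uv∈ uv → keyChoice-true G π (proj₁ (agrees v uv∈) uv))
    (λ {u} {v} uv∈ vu → keyChoice-false G π (λ u≺v → no-opposite-arcs G O∈ acyclic (proj₂ (agrees v uv∈) u≺v) vu))
    where
    π = sinkParent O
    agrees : ∀ v {u} → (u , v) ∈ edges G → Agrees G O∈ acyclic u v
    agrees v = agrees-below G O∈ acyclic n peo v (toℕ<n v)

  ao≤isf : ∀ {a b} → isf≡ G a → ao≡ G b → b ≤ a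
  ao≤isf count-isf count-ao =
    count-by-injection _≟ₗ_ count-ao count-isf (orientations-unique (edges G) (edges-loop-free G))
      (λ O → forestOf G (sinkParent O))
      (λ _ _ → forestOf-sublist G (sinkParent _) , forestOf-isf G (sinkParent _))
      injective [] [] (λ ()) (λ _ _ ())
    where
    injective : ∀ {O O′} → O ∈ orientations (edges G) → O′ ∈ orientations (edges G) → IsAcyclic O → IsAcyclic O′ →
                forestOf G (sinkParent O) ≡ forestOf G (sinkParent O′) → O ≡ O′
    injective {O} {O′} O∈ O′∈ acyclic acyclic′ same = begin
      O                                 ≡⟨ acyclic⇒keyOrientation O∈ acyclic ⟩
      keyOrientation G (sinkParent O)   ≡⟨ keyOrientation-cong G (inGraph⇒decreasing G inG) (forestOf-injective G inG inG′ same) ⟩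
      keyOrientation G (sinkParent O′)  ≡⟨ sym (acyclic⇒keyOrientation O′∈ acyclic′) ⟩
      O′                                ∎
      where
      open ≡-Reasoning
      inG = sinkParent-inGraph G O∈ acyclic
      inG′ = sinkParent-inGraph G O′∈ acyclic′

module Lex {A : Set} (f g : A → ℕ) (_⊏_ : ℕ → ℕ → Set)
           (⊏-trans : ∀ {a b c} → a ⊏ b → b ⊏ c → a ⊏ c) (⊏-irrefl : ∀ {a} → ¬ a ⊏ a)
           (_⊏?_ : ∀ a b → Dec (a ⊏ b)) (⊏-total : ∀ {a b} → a ≢ b → a ⊏ b ⊎ b ⊏ a) where

  _◁_ : A → A → Set
  x ◁ y = f x < f y ⊎ (f x ≡ f y × g x ⊏ g y)

  ◁-trans : ∀ {x y z} → x ◁ y → y ◁ z → x ◁ z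
  ◁-trans         (inj₁ p)       (inj₁ q)        = inj₁ (<-trans p q)
  ◁-trans {x}     (inj₁ p)       (inj₂ (e , _))  = inj₁ (subst (f x <_) e p)
  ◁-trans {z = z} (inj₂ (e , _)) (inj₁ q)        = inj₁ (subst (_< f z) (sym e) q)
  ◁-trans         (inj₂ (e , p)) (inj₂ (e′ , q)) = inj₂ (trans e e′ , ⊏-trans p q)

  ◁-irrefl : ∀ {x} → ¬ x ◁ x
  ◁-irrefl (inj₁ p)       = <-irrefl refl p
  ◁-irrefl (inj₂ (_ , p)) = ⊏-irrefl p

  _◁?_ : ∀ x y → Dec (x ◁ y)
  x ◁? y = (f x <? f y) ⊎-dec ((f x ≟ f y) ×-dec (g x ⊏? g y))

  ◁-total : ∀ {x y} → (f x ≡ f y → g x ≢ g y) → x ◁ y ⊎ y ◁ x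
  ◁-total {x} {y} separated with <-cmp (f x) (f y)
  ... | tri< p _ _ = inj₁ (inj₁ p)
  ... | tri> _ _ p = inj₂ (inj₁ p)
  ... | tri≈ _ e _ with ⊏-total (separated e)
  ...   | inj₁ p = inj₁ (inj₂ (e , p))
  ...   | inj₂ p = inj₂ (inj₂ (sym e , p))

  ◁⇔f< : ∀ {x y} → f x ≢ f y → x ◁ y ⇔ f x < f y
  ◁⇔f< f-differs = mk⇔ (λ { (inj₁ p) → p ; (inj₂ (e , _)) → ⊥-elim (f-differs e) }) inj₁

_<[_]_ : ℕ → Bool → ℕ → Set
a <[ true ]  b = a < b
a <[ false ] b = b < a

<[]-trans : ∀ d {a b c} → a <[ d ] b → b <[ d ] c → a <[ d ] c
<[]-trans true  p q = <-trans p q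
<[]-trans false p q = <-trans q p

<[]-irrefl : ∀ d {a} → ¬ a <[ d ] a
<[]-irrefl true  = <-irrefl refl
<[]-irrefl false = <-irrefl refl

<[]-dec : ∀ d a b → Dec (a <[ d ] b)
<[]-dec true  a b = a <? b
<[]-dec false a b = b <? a

<[]-total : ∀ d {a b} → a ≢ b → a <[ d ] b ⊎ b <[ d ] a
<[]-total d {a} {b} a≢b with <-cmp a b | d
... | tri< p _ _ | true  = inj₁ p
... | tri< p _ _ | false = inj₂ p
... | tri≈ _ e _ | _     = ⊥-elim (a≢b e)
... | tri> _ _ p | true  = inj₂ p
... | tri> _ _ p | false = inj₁ p

-- Third count: a violation i < j < k (ik, jk edges, ij not) whose apex k
-- is minimal yields an acyclic orientation that is no key orientation.
-- Squeeze i, j, k into the slot of i, ordered i, k, j or j, k, i, and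
-- order all other vertices by label.  Below k the two orientations agree,
-- so by `parents-determined` every parent function realising either of
-- them has the keys of the sink parent function π₁ below k.  If π₁ puts
-- j before i, the order i, k, j would force key j ≺ key i ≺ key k although
-- k precedes j; otherwise the order j, k, i fails symmetrically.

module MinimalViolation {n : ℕ} (G : Graph n) {i j k : Fin n} (i<j : i <ᶠ j) (j<k : j <ᶠ k)
  (ik : adj G i k ≡ true) (jk : adj G j k ≡ true) (ij : adj G i j ≡ false) (peo : PEOBelow G (toℕ k)) where

  data Role (v : Fin n) : Set where
    at-i    : v ≡ i → Role v
    at-j    : v ≡ j → Role v
    at-k    : v ≡ k → Role v
    outside : v ≢ i → v ≢ j → v ≢ k → Role v

  role : ∀ v → Role v
  role v with v ≟ᶠ i | v ≟ᶠ j | v ≟ᶠ k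
  ... | yes v≡i | _       | _       = at-i v≡i
  ... | no _    | yes v≡j | _       = at-j v≡j
  ... | no _    | no _    | yes v≡k = at-k v≡k
  ... | no v≢i  | no v≢j  | no v≢k  = outside v≢i v≢j v≢k

  slotOf : ∀ {v} → Role v → ℕ
  slotOf {v} (outside _ _ _) = toℕ v
  slotOf     (at-i _)        = toℕ i
  slotOf     (at-j _)        = toℕ i
  slotOf     (at-k _)        = toℕ i

  positionOf : ∀ {v} → Role v → ℕ
  positionOf (at-i _)        = 0
  positionOf (at-k _)        = 1
  positionOf (at-j _)        = 2
  positionOf (outside _ _ _) = 0

  slot position : Fin n → ℕ
  slot v = slotOf (role v)
  position v = positionOf (role v)

  separated : ∀ {u v} → u ≢ v → slot u ≡ slot v → position u ≢ position v
  separated {u} {v} u≢v = by-roles (role u) (role v)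
    where
    by-roles : (ru : Role u) (rv : Role v) → slotOf ru ≡ slotOf rv → positionOf ru ≢ positionOf rv
    by-roles (outside _ _ _)   (outside _ _ _)   e _ = u≢v (toℕ-injective e)
    by-roles (outside u≢i _ _) (at-i _)          e _ = u≢i (toℕ-injective e)
    by-roles (outside u≢i _ _) (at-j _)          e _ = u≢i (toℕ-injective e)
    by-roles (outside u≢i _ _) (at-k _)          e _ = u≢i (toℕ-injective e)
    by-roles (at-i _)          (outside v≢i _ _) e _ = v≢i (toℕ-injective (sym e))
    by-roles (at-j _)          (outside v≢i _ _) e _ = v≢i (toℕ-injective (sym e))
    by-roles (at-k _)          (outside v≢i _ _) e _ = v≢i (toℕ-injective (sym e))
    by-roles (at-i refl)       (at-i refl)       _ _ = u≢v refl
    by-roles (at-j refl)       (at-j refl)       _ _ = u≢v refl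
    by-roles (at-k refl)       (at-k refl)       _ _ = u≢v refl
    by-roles (at-i _) (at-j _) _ ()
    by-roles (at-i _) (at-k _) _ ()
    by-roles (at-j _) (at-i _) _ ()
    by-roles (at-j _) (at-k _) _ ()
    by-roles (at-k _) (at-i _) _ ()
    by-roles (at-k _) (at-j _) _ ()

  edge-below-k-separated : ∀ {u v} → (u , v) ∈ edges G → v <ᶠ k → slot u ≢ slot v
  edge-below-k-separated {u} {v} uv∈ v<k = by-roles (role u) (role v)
    where
    u<v = edges-ordered G uv∈
    by-roles : (ru : Role u) (rv : Role v) → slotOf ru ≢ slotOf rv
    by-roles _                 (at-k refl)       _ = <-irrefl refl v<k
    by-roles (at-k refl)       _                 _ = <-asym u<v v<k
    by-roles (at-i refl)       (at-i refl)       _ = <-irrefl refl u<v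
    by-roles (at-j refl)       (at-j refl)       _ = <-irrefl refl u<v
    by-roles (at-i refl)       (at-j refl)       _ with trans (sym (proj₂ (edges-sound G uv∈))) ij
    ... | ()
    by-roles (at-j refl)       (at-i refl)       _ = <-asym u<v i<j
    by-roles (outside u≢i _ _) (at-i _)          e = u≢i (toℕ-injective e)
    by-roles (outside u≢i _ _) (at-j _)          e = u≢i (toℕ-injective e)
    by-roles (at-i _)          (outside v≢i _ _) e = v≢i (toℕ-injective (sym e))
    by-roles (at-j _)          (outside v≢i _ _) e = v≢i (toℕ-injective (sym e))
    by-roles (outside _ _ _)   (outside _ _ _)   e = <-irrefl e u<v

  module Squeeze (d : Bool) = Lex slot position (λ a b → a <[ d ] b) (<[]-trans d) (<[]-irrefl d) (<[]-dec d) (<[]-total d)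
  open Squeeze using (_◁_; _◁?_)

  -- the squeezed orientation in direction d: acyclic, as it follows a strict
  -- order that separates every edge
  squeezed : Bool → List (Edge n)
  squeezed d = orient (along (_◁?_ d)) (edges G)

  squeezed-∈ : ∀ d → squeezed d ∈ orientations (edges G)
  squeezed-∈ d = orient-∈ (along (_◁?_ d)) (edges G)

  squeezed-acyclic : ∀ d → IsAcyclic (squeezed d)
  squeezed-acyclic d = orient-along-acyclic {R = _◁_ d} (Squeeze.◁-trans d) (Squeeze.◁-irrefl d) (_◁?_ d) (edges G)
    λ uv∈ → Squeeze.◁-total d (separated (edges-loop-free G uv∈))

  squeezed-below-k : ∀ d {u v} → (u , v) ∈ edges G → v <ᶠ k →
                     along (_◁?_ d) (u , v) ≡ does (slot u <? slot v)
  squeezed-below-k d {u} {v} uv∈ v<k =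
    does-⇔ (Squeeze.◁⇔f< d {u} {v} (edge-below-k-separated uv∈ v<k)) (_◁?_ d u v) (slot u <? slot v)

  placed-i : slot i ≡ toℕ i × position i ≡ 0
  placed-i with role i
  ... | at-i _       = refl , refl
  ... | at-j i≡j     = ⊥-elim (<-irrefl (cong toℕ i≡j) i<j)
  ... | at-k i≡k     = ⊥-elim (<-irrefl (cong toℕ i≡k) (<-trans i<j j<k))
  ... | outside i≢i _ _ = ⊥-elim (i≢i refl)

  placed-j : slot j ≡ toℕ i × position j ≡ 2
  placed-j with role j
  ... | at-i j≡i     = ⊥-elim (<-irrefl (cong toℕ (sym j≡i)) i<j)
  ... | at-j _       = refl , refl
  ... | at-k j≡k     = ⊥-elim (<-irrefl (cong toℕ j≡k) j<k)
  ... | outside _ j≢j _ = ⊥-elim (j≢j refl)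

  placed-k : slot k ≡ toℕ i × position k ≡ 1
  placed-k with role k
  ... | at-i k≡i     = ⊥-elim (<-irrefl (cong toℕ (sym k≡i)) (<-trans i<j j<k))
  ... | at-j k≡j     = ⊥-elim (<-irrefl (cong toℕ (sym k≡j)) j<k)
  ... | at-k _       = refl , refl
  ... | outside _ _ k≢k = ⊥-elim (k≢k refl)

  first last : Bool → Fin n
  first true  = i
  first false = j
  last  true  = j
  last  false = i

  first-before-k : ∀ d → _◁_ d (first d) k
  first-before-k true  = inj₂ (trans (proj₁ placed-i) (sym (proj₁ placed-k)) ,
                              subst₂ _<_ (sym (proj₂ placed-i)) (sym (proj₂ placed-k)) (s≤s z≤n))
  first-before-k false = inj₂ (trans (proj₁ placed-j) (sym (proj₁ placed-k)) ,
                              subst₂ _<_ (sym (proj₂ placed-k)) (sym (proj₂ placed-j)) (s≤s (s≤s z≤n)))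

  k-before-last : ∀ d → _◁_ d k (last d)
  k-before-last true  = inj₂ (trans (proj₁ placed-k) (sym (proj₁ placed-j)) ,
                             subst₂ _<_ (sym (proj₂ placed-k)) (sym (proj₂ placed-j)) (s≤s (s≤s z≤n)))
  k-before-last false = inj₂ (trans (proj₁ placed-k) (sym (proj₁ placed-i)) ,
                             subst₂ _<_ (sym (proj₂ placed-i)) (sym (proj₂ placed-k)) (s≤s z≤n))

  first-k-edge : ∀ d → (first d , k) ∈ edges G
  first-k-edge true  = edges-complete G (<-trans i<j j<k) ik
  first-k-edge false = edges-complete G j<k jk

  last-k-edge : ∀ d → (last d , k) ∈ edges G
  last-k-edge true  = edges-complete G j<k jk
  last-k-edge false = edges-complete G (<-trans i<j j<k) ik

  first-below-k : ∀ d → first d <ᶠ k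
  first-below-k d = edges-ordered G (first-k-edge d)

  last-below-k : ∀ d → last d <ᶠ k
  last-below-k d = edges-ordered G (last-k-edge d)

  π₁ : ParentFn n
  π₁ = sinkParent (squeezed true)

  π₁-inGraph : InGraph G π₁
  π₁-inGraph = sinkParent-inGraph G (squeezed-∈ true) (squeezed-acyclic true)

  π₁-below-k : ∀ {u v} → (u , v) ∈ edges G → v <ᶠ k → keyChoice G π₁ (u , v) ≡ along (_◁?_ true) (u , v)
  π₁-below-k {u} {v} uv∈ v<k = bool-ext
    (λ chosen → Equivalence.to arc⇔ (proj₂ agrees (keyChoice-sound G π₁ chosen)))
    (λ chosen → keyChoice-true G π₁ (proj₁ agrees (Equivalence.from arc⇔ chosen)))
    where
    agrees = agrees-below G (squeezed-∈ true) (squeezed-acyclic true) (toℕ k) peo v v<k uv∈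
    arc⇔ = orient-choice (along (_◁?_ true)) (edges G) (squeezed-acyclic true) uv∈ (edges-loop-free G uv∈)
    bool-ext : ∀ {a b : Bool} → (a ≡ true → b ≡ true) → (b ≡ true → a ≡ true) → a ≡ b
    bool-ext {true}  {true}  _ _ = refl
    bool-ext {false} {false} _ _ = refl
    bool-ext {true}  {false} f _ = sym (f refl)
    bool-ext {false} {true}  _ g = g refl

  realising-keys : ∀ d {π} → InGraph G π → keyOrientation G π ≡ squeezed d →
                   ∀ x → x <ᶠ k → key π x ≡ key π₁ x
  realising-keys d {π} inG realises x x<k =
    key-local (inGraph⇒decreasing G inG) x λ w w≤x →
      parents-determined G (toℕ k) inG π₁-inGraph same-arcs w (≤-<-trans w≤x x<k)
    where
    same-arcs : ∀ {u v} → (u , v) ∈ edges G → toℕ v < toℕ k → keyChoice G π (u , v) ≡ keyChoice G π₁ (u , v)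
    same-arcs {u} {v} uv∈ v<k = begin
      keyChoice G π (u , v)      ≡⟨ orient-injective (keyChoice G π) (along (_◁?_ d)) (edges G) (edges-loop-free G) realises uv∈ ⟩
      along (_◁?_ d) (u , v)     ≡⟨ squeezed-below-k d uv∈ v<k ⟩
      does (slot u <? slot v)    ≡⟨ sym (squeezed-below-k true uv∈ v<k) ⟩
      along (_◁?_ true) (u , v)  ≡⟨ sym (π₁-below-k uv∈ v<k) ⟩
      keyChoice G π₁ (u , v)     ∎
      where open ≡-Reasoning

  -- if π₁ puts last d before first d, no parent function realises the squeeze d:
  -- it would need key (last d) ≺ key (first d) ≺ key k, while k precedes last d
  not-realised : ∀ d → key π₁ (last d) ≺ key π₁ (first d) → ∀ π → InGraph G π → keyOrientation G π ≢ squeezed d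
  not-realised d last≺first π inG realises = true≢false
    (trans (sym (keyChoice-true G π (≺-trans last≺first′ first≺k)))
           (trans (choice (last-k-edge d)) (dec-false (_◁?_ d (last d) k) last-after-k)))
    where
    true≢false : true ≢ false
    true≢false ()
    choice : ∀ {e} → e ∈ edges G → keyChoice G π e ≡ along (_◁?_ d) e
    choice = orient-injective (keyChoice G π) (along (_◁?_ d)) (edges G) (edges-loop-free G) realises
    keys = realising-keys d inG realises
    last≺first′ : key π (last d) ≺ key π (first d)
    last≺first′ = subst₂ _≺_ (sym (keys (last d) (last-below-k d))) (sym (keys (first d) (first-below-k d))) last≺first
    first≺k : key π (first d) ≺ key π k
    first≺k = keyChoice-sound G π (trans (choice (first-k-edge d)) (dec-true (_◁?_ d (first d) k) (first-before-k d)))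
    last-after-k : ¬ _◁_ d (last d) k
    last-after-k last◁k = Squeeze.◁-irrefl d (Squeeze.◁-trans d last◁k (k-before-last d))

  missed-orientation : Σ (List (Edge n)) λ O → O ∈ orientations (edges G) × IsAcyclic O ×
                       (∀ π → InGraph G π → keyOrientation G π ≢ O)
  missed-orientation with key-distinct π₁ (λ i≡j → <-irrefl (cong toℕ i≡j) i<j)
  ... | inj₁ i≺j = squeezed false , squeezed-∈ false , squeezed-acyclic false , not-realised false i≺j
  ... | inj₂ j≺i = squeezed true  , squeezed-∈ true  , squeezed-acyclic true  , not-realised true j≺i

module _ {n : ℕ} (G : Graph n) where

  Violation : Fin n → Fin n → Fin n → Set
  Violation i j k = i <ᶠ j × j <ᶠ k × adj G i k ≡ true × adj G j k ≡ true × adj G i j ≡ false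

  violation? : ∀ i j k → Dec (Violation i j k)
  violation? i j k = (toℕ i <? toℕ j) ×-dec (toℕ j <? toℕ k) ×-dec (adj G i k ≟ᵇ true) ×-dec
                     (adj G j k ≟ᵇ true) ×-dec (adj G i j ≟ᵇ false)

  ViolationBelow : ℕ → Set
  ViolationBelow m = ∃ λ i → ∃ λ j → ∃ λ k → toℕ k < m × Violation i j k

  violationBelow? : ∀ m → Dec (ViolationBelow m)
  violationBelow? m = any? λ i → any? λ j → any? λ k → (toℕ k <? m) ×-dec violation? i j k

  minimal-violation : ∀ {i j k} → Violation i j k →
    Σ (Fin n) λ i → Σ (Fin n) λ j → Σ (Fin n) λ k → Violation i j k × PEOBelow G (toℕ k)
  minimal-violation {k = k} = descend (suc (toℕ k)) ≤-refl
    where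
    descend : ∀ m {i j k} → toℕ k < m → Violation i j k →
      Σ (Fin n) λ i → Σ (Fin n) λ j → Σ (Fin n) λ k → Violation i j k × PEOBelow G (toℕ k)
    descend (suc m) {i} {j} {k} (s≤s k≤m) v with violationBelow? (toℕ k)
    ... | yes (_ , _ , _ , k′<k , v′) = descend m (<-≤-trans k′<k k≤m) v′
    ... | no none = i , j , k , v , peo-below
      where
      peo-below : PEOBelow G (toℕ k)
      peo-below i′ j′ k′ i′<j′ j′<k′ k′<k i′k′ j′k′ with adj G i′ j′ in i′j′
      ... | true  = refl
      ... | false = ⊥-elim (none (i′ , j′ , k′ , k′<k , i′<j′ , j′<k′ , i′k′ , j′k′ , i′j′))

  isf<ao : ∀ {a b} → isf≡ G a → ao≡ G b → ∀ {i j k} → Violation i j k → suc a ≤ b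
  isf<ao count-isf count-ao v with minimal-violation v
  ... | _ , _ , _ , (i<j , j<k , ik , jk , ij) , peo
    with MinimalViolation.missed-orientation G i<j j<k ik jk ij peo
  ...   | O , O∈ , acyclic , missed =
    isf+missed≤ao G count-isf count-ao [ O ] ([] ∷ [])
      (λ { (here refl) → O∈ , acyclic })
      (λ { (here refl) → missed })

mainTheorem4 : ∀ (n : ℕ) (G : Graph n) (a b : ℕ) →
    isf≡ G a → ao≡ G b →
    (a ≤ b) × ((a ≡ b) ⇔ IsPEO G)
mainTheorem4 n G a b count-isf count-ao = isf≤ao , mk⇔ equal⇒peo peo⇒equal
  where
  isf≤ao : a ≤ b
  isf≤ao = isf+missed≤ao G count-isf count-ao [] [] (λ ()) (λ ())
  equal⇒peo : a ≡ b → IsPEO G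
  equal⇒peo a≡b i j k i<j j<k ik jk with adj G i j in ij
  ... | true  = refl
  ... | false = ⊥-elim (<-irrefl a≡b (isf<ao G count-isf count-ao (i<j , j<k , ik , jk , ij)))
  peo⇒equal : IsPEO G → a ≡ b
  peo⇒equal peo = ≤-antisym isf≤ao (ao≤isf G (λ i j k i<j j<k _ → peo i j k i<j j<k) count-isf count-ao)
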